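{- Let $m,n\ge2$ be integers, $R=[0,m-1]\times[0,n-1]$ and $u\in\ker BW\setminus\{0\}$. Let $C$ be a chunk of $\Phi_b(u)$ having a side $s$ which is active and horizontal or vertical, and such that the interior angles of $C$ at both endpoints of $s$ equal $\pi/2$. Then $C$ is a square with sides of length $2$.
   Context: $G=R\cap\mathbb{Z}^2$ is the $m\times n$ rectangular graph, with $(x,y),(x',y')$ adjacent in $G$ iff $|x-x'|+|y-y'|=1$; a point is black if $x+y$ is even, white otherwise. $BW$ maps a $\mathbb{Z}/(2)$-valued function $u$ on black points of $G$ to the function on white points $w\mapsto\sum_{b\text{ black neighbor of }w}u(b)\pmod 2$. $A_u$ is the set of black points $b$ with $u(b)=1$. Two points $b_1,b_2\in A_u$ are adjacent in $A_u$ if (i) they have a common white neighbor $w$ in $G$, and (ii) either $\overline{wb_1}\perp\overline{wb_2}$, or $b_1,b_2$ are the only points of $A_u$ among the neighbors of $w$; the segments $\overline{b_1b_2}$ for adjacent $b_1,b_2$ are the segments of $A_u$. $\Phi_b(u)$ is $\mathrm{int}(R)$ minus the union of the segments of $A_u$; its chunks are the closures of its connected components, which are convex polygons. A side of a chunk (a maximal straight piece of its boundary) is active if it consists only of segments of $A_u$. -}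

module Defs where

open import Data.Nat using (ℕ; zero; suc; _+_; _*_; _<_; _≤_; _%_; _<ᵇ_)
open import Data.Integer as ℤ using (ℤ; +_)
open import Data.Bool using (Bool; true; false; _∧_; if_then_else_)
open import Data.Product using (Σ; ∃; ∃-syntax; _×_; _,_)
open import Data.Sum using (_⊎_)
open import Data.Empty using (⊥)
open import Data.List using (List; []; _∷_; _++_; length; filterᵇ)
open import Relation.Binary.PropositionalEquality using (_≡_; _≢_)
open import Relation.Nullary using (¬_)
open import Relation.Binary.Construct.Closure.ReflexiveTransitive using (Star)
open import Relation.Binary.Construct.Closure.Symmetric using (SymClosure)

-- The grid graph G = R ∩ ℤ², R = [0,m-1]×[0,n-1]

Point : Set
Point = ℕ × ℕ

InG : ℕ → ℕ → Point → Set
InG m n (x , y) = x < m × y < n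

inGᵇ : ℕ → ℕ → Point → Bool
inGᵇ m n (x , y) = (x <ᵇ m) ∧ (y <ᵇ n)

Black : Point → Set
Black (x , y) = (x + y) % 2 ≡ 0

White : Point → Set
White (x , y) = (x + y) % 2 ≡ 1

Nbr : Point → Point → Set
Nbr (x , y) (x' , y') =
  (x ≡ x' × (suc y ≡ y' ⊎ suc y' ≡ y)) ⊎ (y ≡ y' × (suc x ≡ x' ⊎ suc x' ≡ x))

-- the lattice neighbours (in ℕ²) of a point; intersect with G via inGᵇ
private
  left : Point → List Point
  left (zero , y) = []
  left (suc x , y) = (x , y) ∷ []
  down : Point → List Point
  down (x , zero) = []
  down (x , suc y) = (x , y) ∷ []

latticeNbrs : Point → List Point
latticeNbrs (x , y) = (suc x , y) ∷ (x , suc y) ∷ (left (x , y) ++ down (x , y))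

-- A ℤ/2-valued function on black points is modelled as u : Point → Bool;
-- only its values at black points of G are ever used.
-- (BW u)(w) = Σ_{b black neighbour of w in G} u(b)  (mod 2)
BW : ℕ → ℕ → (Point → Bool) → Point → ℕ
BW m n u w = length (filterᵇ (λ b → inGᵇ m n b ∧ u b) (latticeNbrs w)) % 2

InKerBW : ℕ → ℕ → (Point → Bool) → Set
InKerBW m n u = ∀ w → InG m n w → White w → BW m n u w ≡ 0

NonZeroU : ℕ → ℕ → (Point → Bool) → Set
NonZeroU m n u = ∃[ b ] (InG m n b × Black b × u b ≡ true)

InA : ℕ → ℕ → (Point → Bool) → Point → Set
InA m n u b = InG m n b × Black b × u b ≡ true

toℤ² : Point → ℤ × ℤ
toℤ² (x , y) = (+ x , + y)

sub : ℤ × ℤ → ℤ × ℤ → ℤ × ℤ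
sub (a , b) (c , d) = (a ℤ.- c , b ℤ.- d)

dot : ℤ × ℤ → ℤ × ℤ → ℤ
dot (a , b) (c , d) = a ℤ.* c ℤ.+ b ℤ.* d

cross : ℤ × ℤ → ℤ × ℤ → ℤ
cross (a , b) (c , d) = a ℤ.* d ℤ.- b ℤ.* c

Perp : Point → Point → Point → Set
Perp w b₁ b₂ = dot (sub (toℤ² b₁) (toℤ² w)) (sub (toℤ² b₂) (toℤ² w)) ≡ + 0

AdjA : ℕ → ℕ → (Point → Bool) → Point → Point → Set
AdjA m n u b₁ b₂ =
  InA m n u b₁ × InA m n u b₂ × b₁ ≢ b₂ ×
  ∃[ w ] (InG m n w × White w × Nbr w b₁ × Nbr w b₂ ×
          (Perp w b₁ b₂ ⊎
           (∀ b → InA m n u b → Nbr w b → (b ≡ b₁ ⊎ b ≡ b₂))))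

OnSeg : ℤ × ℤ → ℤ × ℤ → ℤ × ℤ → Set
OnSeg P B₁ B₂ =
  cross (sub P B₁) (sub B₂ B₁) ≡ + 0 ×
  + 0 ℤ.≤ dot (sub P B₁) (sub B₂ B₁) ×
  dot (sub P B₁) (sub B₂ B₁) ℤ.≤ dot (sub B₂ B₁) (sub B₂ B₁)

-- Points in "doubled" coordinates: (X , Y) stands for (X/2 , Y/2).
dbl : Point → ℤ × ℤ
dbl (x , y) = (+ (2 * x) , + (2 * y))

-- the straight piece from P to Q (doubled coordinates) is contained in a
-- segment of A_u
Covered : ℕ → ℕ → (Point → Bool) → Point → Point → Set
Covered m n u P Q =
  ∃[ b₁ ] ∃[ b₂ ] (AdjA m n u b₁ b₂ ×
     OnSeg (toℤ² P) (dbl b₁) (dbl b₂) × OnSeg (toℤ² Q) (dbl b₁) (dbl b₂))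

-- Cells: each unit square [i,i+1]×[j,j+1] ⊆ R is cut by its two diagonals
-- into four closed triangles S (bottom), E (right), N (top), W (left).
-- Every segment of A_u is a union of edges of these triangles.

data Tri : Set where
  S E N W : Tri

Cell : Set
Cell = ℕ × ℕ × Tri

ValidCell : ℕ → ℕ → Cell → Set
ValidCell m n (i , j , _) = suc i < m × suc j < n

-- doubled coordinates of the centre of square (i,j) and of lattice point (x,y)
ctr : ℕ → ℕ → Point
ctr i j = (suc (2 * i) , suc (2 * j))

cor : ℕ → ℕ → Point
cor x y = (2 * x , 2 * y)

-- two cells sharing an edge which is not contained in a segment of A_u
data Link (m n : ℕ) (u : Point → Bool) : Cell → Cell → Set where
  lSE : ∀ {i j} → ValidCell m n (i , j , S) →
        ¬ Covered m n u (ctr i j) (cor (suc i) j) → Link m n u (i , j , S) (i , j , E)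
  lEN : ∀ {i j} → ValidCell m n (i , j , E) →
        ¬ Covered m n u (ctr i j) (cor (suc i) (suc j)) → Link m n u (i , j , E) (i , j , N)
  lNW : ∀ {i j} → ValidCell m n (i , j , N) →
        ¬ Covered m n u (ctr i j) (cor i (suc j)) → Link m n u (i , j , N) (i , j , W)
  lWS : ∀ {i j} → ValidCell m n (i , j , W) →
        ¬ Covered m n u (ctr i j) (cor i j) → Link m n u (i , j , W) (i , j , S)
  lNS : ∀ {i j} → ValidCell m n (i , j , N) → ValidCell m n (i , suc j , S) →
        ¬ Covered m n u (cor i (suc j)) (cor (suc i) (suc j)) →
        Link m n u (i , j , N) (i , suc j , S)
  lEW : ∀ {i j} → ValidCell m n (i , j , E) → ValidCell m n (suc i , j , W) →
        ¬ Covered m n u (cor (suc i) j) (cor (suc i) (suc j)) →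
        Link m n u (i , j , E) (suc i , j , W)

-- The chunk of Φ_b(u) containing the (valid) cell c₀, represented by the
-- set of cells whose union it is (closure of a connected component).
Chunk : ℕ → ℕ → (Point → Bool) → Cell → Cell → Set
Chunk m n u c₀ = Star (SymClosure (Link m n u)) c₀

-- horizontal unit edge [x,x+1]×{j}: cell below / above
belowH : (Cell → Set) → ℕ → ℕ → Set
belowH C x zero = ⊥
belowH C x (suc j) = C (x , j , N)

aboveH : (Cell → Set) → ℕ → ℕ → Set
aboveH C x j = C (x , j , S)

BdH : (Cell → Set) → ℕ → ℕ → Set
BdH C x j = (belowH C x j × ¬ aboveH C x j) ⊎ (¬ belowH C x j × aboveH C x j)

-- vertical unit edge {i}×[y,y+1]: cell left / right
leftV : (Cell → Set) → ℕ → ℕ → Set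
leftV C zero y = ⊥
leftV C (suc i) y = C (i , y , E)

rightV : (Cell → Set) → ℕ → ℕ → Set
rightV C i y = C (i , y , W)

BdV : (Cell → Set) → ℕ → ℕ → Set
BdV C i y = (leftV C i y × ¬ rightV C i y) ⊎ (¬ leftV C i y × rightV C i y)

-- [a,b]×{j} is a side (maximal straight piece of the boundary) of C
HSide : (Cell → Set) → ℕ → ℕ → ℕ → Set
HSide C j a b =
  a < b × (∀ x → a ≤ x → x < b → BdH C x j) ×
  (∀ a' → suc a' ≡ a → ¬ BdH C a' j) × ¬ BdH C b j

VSide : (Cell → Set) → ℕ → ℕ → ℕ → Set
VSide C i a b =
  a < b × (∀ y → a ≤ y → y < b → BdV C i y) ×
  (∀ a' → suc a' ≡ a → ¬ BdV C i a') × ¬ BdV C i b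

ActiveH : ℕ → ℕ → (Point → Bool) → ℕ → ℕ → ℕ → Set
ActiveH m n u j a b = ∀ x → a ≤ x → x < b → Covered m n u (cor x j) (cor (suc x) j)

ActiveV : ℕ → ℕ → (Point → Bool) → ℕ → ℕ → ℕ → Set
ActiveV m n u i a b = ∀ y → a ≤ y → y < b → Covered m n u (cor i y) (cor i (suc y))

-- the (up to 8) cells having the lattice point (x,y) as a vertex;
-- each of them has angle π/4 at (x,y)
private
  sqLL sqLR sqUL sqUR : ℕ → ℕ → List Cell
  sqLL x y = (x , y , S) ∷ (x , y , W) ∷ []
  sqLR zero y = []
  sqLR (suc x) y = (x , y , S) ∷ (x , y , E) ∷ []
  sqUL x zero = []
  sqUL x (suc y) = (x , y , N) ∷ (x , y , W) ∷ []
  sqUR zero y = []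
  sqUR (suc x) zero = []
  sqUR (suc x) (suc y) = (x , y , E) ∷ (x , y , N) ∷ []

cornerCells : ℕ → ℕ → List Cell
cornerCells x y = sqLL x y ++ sqLR x y ++ sqUL x y ++ sqUR x y

data ExactlyCount (P : Cell → Set) : List Cell → ℕ → Set where
  ec[] : ExactlyCount P [] 0
  ecYes : ∀ {c cs k} → P c → ExactlyCount P cs k → ExactlyCount P (c ∷ cs) (suc k)
  ecNo : ∀ {c cs k} → ¬ P c → ExactlyCount P cs k → ExactlyCount P (c ∷ cs) k

-- the interior angle of C at the lattice point (x,y) is π/2
-- (interior angle = (number of cells of C at (x,y)) · π/4)
RightAngleAt : (Cell → Set) → ℕ → ℕ → Set
RightAngleAt C x y = ExactlyCount C (cornerCells x y) 2

HasActiveRightSide : ℕ → ℕ → (Point → Bool) → (Cell → Set) → Set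
HasActiveRightSide m n u C =
  (∃[ j ] ∃[ a ] ∃[ b ] (HSide C j a b × ActiveH m n u j a b ×
                           RightAngleAt C a j × RightAngleAt C b j))
  ⊎
  (∃[ i ] ∃[ a ] ∃[ b ] (VSide C i a b × ActiveV m n u i a b ×
                           RightAngleAt C i a × RightAngleAt C i b))

InSq2 : ℕ → ℕ → Cell → Set
InSq2 a b (i , j , _) = (i ≡ a ⊎ i ≡ suc a) × (j ≡ b ⊎ j ≡ suc b)

IsSquare2 : (Cell → Set) → Set
IsSquare2 C = ∃[ a ] ∃[ b ] (∀ c → (C c → InSq2 a b c) × (InSq2 a b c → C c))

-- Transposing the grid, we may assume that the side s = [a , b] × {j} is horizontal with C above
-- it (C below it is symmetric).  The first unit edge of s lies on a horizontal segment of A_u, which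
-- must start at (a , j): were (a , j) its midpoint, C would have three triangles at (a , j).  So
-- (a , j) and (a + 2 , j) are in A_u and (a + 1 , j + 1) is not.  The vertical segment from (a , j)
-- to (a , j + 2) exists, since otherwise the triangle left of the vertical edge at (a , j) would join
-- C and widen its angle there; on the border of the grid the kernel condition at (a , j + 1) gives
-- it instead.  The same argument works at a + 2 when b = a + 2; b = a + 1 is impossible, and for
-- b > a + 2 the next segment of s keeps (a + 3 , j + 1) out of A_u, so the kernel condition at
-- (a + 2 , j + 1) gives the segment.  The kernel condition at (a + 1 , j + 2) then shows that the top
-- side is a segment too, and no link leaves a square framed by four segments whose centre is not
-- in A_u.

module Submission where

open import Defs
open import Data.Bool using (Bool; true; false; _∧_; _xor_; if_then_else_; T)
import Data.Bool.Properties as 𝔹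
open import Data.Empty using (⊥-elim)
open import Data.Integer using (ℤ; +_; +≤+; nonNegative)
  renaming (_+_ to _+ᶻ_; _-_ to _-ᶻ_; _*_ to _*ᶻ_; -_ to -ᶻ_; _≤_ to _≤ᶻ_)
import Data.Integer.Properties as ℤₚ
open import Data.Integer.Tactic.RingSolver using (solve-∀)
open import Data.List using (List; []; _∷_; length; filterᵇ; map; foldr)
open import Data.List.Properties using (map-cong; map-∘)
import Data.List.Relation.Binary.Permutation.Propositional as ↭
open ↭ using (_↭_; ↭-sym)
open import Data.List.Relation.Binary.Permutation.Propositional.Properties using (map⁺; shifts)
open import Data.List.Relation.Binary.Sublist.Propositional using (_⊆_; []; _∷_; _∷ʳ_; minimum)
open import Data.List.Relation.Unary.All using (All; []; _∷_)
open import Data.Nat using (ℕ; zero; suc; _+_; _*_; _≤_; _<_; s≤s; z≤n; _%_; _<ᵇ_; _<?_)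
import Data.Nat.Properties as ℕₚ
open import Data.Nat.Tactic.RingSolver using () renaming (solve-∀ to ℕ-solve-∀)
open import Data.Product using (_×_; _,_; proj₁; proj₂; swap)
open import Data.Product.Properties using (≡-dec)
open import Data.Sum using (_⊎_; inj₁; inj₂; [_,_]′)
import Data.Sum
open import Function using (_∘_; Equivalence)
open import Relation.Binary.Construct.Closure.ReflexiveTransitive using (Star; ε; _◅_; _◅◅_; reverse; gmap)
open import Relation.Binary.Construct.Closure.Symmetric using (SymClosure; fwd; bwd; symmetric)
open import Relation.Binary.PropositionalEquality
open import Relation.Nullary using (¬_; yes; no; Dec)
open import Relation.Nullary.Decidable using (_×-dec_; _⊎-dec_; decidable-stable)

-- Doubled coordinates

+a-+b≡0⇒a≡b : ∀ a b → + a -ᶻ + b ≡ + 0 → a ≡ b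
+a-+b≡0⇒a≡b a b h = ℤₚ.+-injective (ℤₚ.i-j≡0⇒i≡j (+ a) (+ b) h)

0≤+a-+b⇒b≤a : ∀ a b → + 0 ≤ᶻ + a -ᶻ + b → b ≤ a
0≤+a-+b⇒b≤a a b h = ℤₚ.drop‿+≤+ (ℤₚ.0≤i-j⇒j≤i h)

+a-+b≤+k⇒a≤k+b : ∀ a b k → + a -ᶻ + b ≤ᶻ + k → a ≤ k + b
+a-+b≤+k⇒a≤k+b a b k h =
  ℤₚ.drop‿+≤+ (subst₂ _≤ᶻ_ (cancel (+ a) (+ b)) (sym (ℤₚ.pos-+ k b)) (ℤₚ.+-monoˡ-≤ (+ b) h))
  where
  cancel : ∀ (a b : ℤ) → (a -ᶻ b) +ᶻ b ≡ a
  cancel = solve-∀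

+a-+b≡+c-+d⇒a+d≡c+b : ∀ a b c d → + a -ᶻ + b ≡ + c -ᶻ + d → a + d ≡ c + b
+a-+b≡+c-+d⇒a+d≡c+b a b c d h = ℤₚ.+-injective (begin
  + (a + d)                       ≡⟨ ℤₚ.pos-+ a d ⟩
  + a +ᶻ + d                      ≡⟨ shift (+ a) (+ b) (+ d) ⟨
  (+ a -ᶻ + b) +ᶻ (+ b +ᶻ + d)    ≡⟨ cong (_+ᶻ (+ b +ᶻ + d)) h ⟩
  (+ c -ᶻ + d) +ᶻ (+ b +ᶻ + d)    ≡⟨ shift′ (+ c) (+ d) (+ b) ⟩
  + c +ᶻ + b                      ≡⟨ ℤₚ.pos-+ c b ⟨
  + (c + b)                       ∎)
  where
  open ≡-Reasoning
  shift : ∀ (a b d : ℤ) → (a -ᶻ b) +ᶻ (b +ᶻ d) ≡ a +ᶻ d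
  shift = solve-∀
  shift′ : ∀ (c d b : ℤ) → (c -ᶻ d) +ᶻ (b +ᶻ d) ≡ c +ᶻ b
  shift′ = solve-∀

+a-+b≡-[+c-+d]⇒a+c≡d+b : ∀ a b c d → + a -ᶻ + b ≡ -ᶻ (+ c -ᶻ + d) → a + c ≡ d + b
+a-+b≡-[+c-+d]⇒a+c≡d+b a b c d h =
  +a-+b≡+c-+d⇒a+d≡c+b a b d c (trans h (negate (+ c) (+ d)))
  where
  negate : ∀ (c d : ℤ) → -ᶻ (c -ᶻ d) ≡ d -ᶻ c
  negate = solve-∀

+[k+a]-+a≡+k : ∀ k a → + (k + a) -ᶻ + a ≡ + k
+[k+a]-+a≡+k k a = trans (cong (_-ᶻ + a) (ℤₚ.pos-+ k a)) (cancel (+ k) (+ a))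
  where
  cancel : ∀ (k a : ℤ) → (k +ᶻ a) -ᶻ a ≡ k
  cancel = solve-∀

+a-+[k+a]≡-+k : ∀ k a → + a -ᶻ + (k + a) ≡ -ᶻ (+ k)
+a-+[k+a]≡-+k k a = trans (cong (λ t → + a -ᶻ t) (ℤₚ.pos-+ k a)) (cancel (+ k) (+ a))
  where
  cancel : ∀ (k a : ℤ) → a -ᶻ (k +ᶻ a) ≡ -ᶻ k
  cancel = solve-∀

2*[1+x]≡2+2*x : ∀ x → 2 * suc x ≡ 2 + 2 * x
2*[1+x]≡2+2*x x = ℕₚ.*-distribˡ-+ 2 1 x

2*[2+x]≡4+2*x : ∀ x → 2 * suc (suc x) ≡ 4 + 2 * x
2*[2+x]≡4+2*x x = ℕₚ.*-distribˡ-+ 2 2 x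

OnOffset : ℤ × ℤ → ℤ × ℤ → Set
OnOffset Q D = cross Q D ≡ + 0 × + 0 ≤ᶻ dot Q D × dot Q D ≤ᶻ dot D D

onSeg⇒onOffset : ∀ P B₁ B₂ {D} → sub B₂ B₁ ≡ D → OnSeg P B₁ B₂ → OnOffset (sub P B₁) D
onSeg⇒onOffset P B₁ B₂ refl h = h

dbl-offset : ∀ x k → + (2 * (k + x)) -ᶻ + (2 * x) ≡ + (2 * k)
dbl-offset x k =
  trans (cong (λ t → + t -ᶻ + (2 * x)) (ℕₚ.*-distribˡ-+ 2 k x)) (+[k+a]-+a≡+k (2 * k) (2 * x))

horizontal-offset : ∀ x y → sub (dbl (suc (suc x) , y)) (dbl (x , y)) ≡ (+ 4 , + 0)
horizontal-offset x y = cong₂ _,_ (dbl-offset x 2) (+[k+a]-+a≡+k 0 (2 * y))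

vertical-offset : ∀ x y → sub (dbl (x , suc (suc y))) (dbl (x , y)) ≡ (+ 0 , + 4)
vertical-offset x y = cong₂ _,_ (+[k+a]-+a≡+k 0 (2 * x)) (dbl-offset y 2)

diagonal-offset : ∀ x y → sub (dbl (suc x , suc y)) (dbl (x , y)) ≡ (+ 2 , + 2)
diagonal-offset x y = cong₂ _,_ (dbl-offset x 1) (dbl-offset y 1)

antidiagonal-offset : ∀ x y → sub (dbl (suc x , y)) (dbl (x , suc y)) ≡ (+ 2 , -ᶻ (+ 2))
antidiagonal-offset x y = cong₂ _,_ (dbl-offset x 1)
  (trans (cong (λ t → + (2 * y) -ᶻ + t) (2*[1+x]≡2+2*x y)) (+a-+[k+a]≡-+k 2 (2 * y)))

scaled-bounds : ∀ (U : ℤ) k → + 0 ≤ᶻ U *ᶻ + 4 → U *ᶻ + 4 ≤ᶻ + k *ᶻ + 4 → + 0 ≤ᶻ U × U ≤ᶻ + k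
scaled-bounds U k h₁ h₂ = ℤₚ.*-cancelʳ-≤-pos (+ 0) U (+ 4) h₁ , ℤₚ.*-cancelʳ-≤-pos U (+ k) (+ 4) h₂

-- The doubled point (X , Y) lies on the segment from (x , y) to (x + 2 , y), to (x , y + 2),
-- to (x + 1 , y + 1), and from (x , y + 1) to (x + 1 , y), respectively.
record OnHorizontal (X Y x y : ℕ) : Set where
  field
    y-eq : Y ≡ 2 * y
    x-lo : 2 * x ≤ X
    x-hi : X ≤ 4 + 2 * x

record OnVertical (X Y x y : ℕ) : Set where
  field
    x-eq : X ≡ 2 * x
    y-lo : 2 * y ≤ Y
    y-hi : Y ≤ 4 + 2 * y

record OnDiagonal (X Y x y : ℕ) : Set where
  field
    xy-eq : X + 2 * y ≡ Y + 2 * x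
    x-lo : 2 * x ≤ X
    x-hi : X ≤ 2 + 2 * x

record OnAntidiagonal (X Y x y : ℕ) : Set where
  field
    xy-eq : X + Y ≡ 2 * suc y + 2 * x
    x-lo : 2 * x ≤ X
    x-hi : X ≤ 2 + 2 * x

onSeg⇒onHorizontal : ∀ X Y x y → OnSeg (+ X , + Y) (dbl (x , y)) (dbl (suc (suc x) , y)) →
                     OnHorizontal X Y x y
onSeg⇒onHorizontal X Y x y h
  with onSeg⇒onOffset (+ X , + Y) (dbl (x , y)) (dbl (suc (suc x) , y)) (horizontal-offset x y) h
... | c , d₁ , d₂ = record
  { y-eq = +a-+b≡0⇒a≡b Y (2 * y) (ℤₚ.*-cancelʳ-≡ V (+ 0) (+ 4)
             (trans (sym (ℤₚ.neg-involutive _)) (cong -ᶻ_ (trans (sym (cross≡ U V)) c))))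
  ; x-lo = 0≤+a-+b⇒b≤a X (2 * x) (proj₁ bounds)
  ; x-hi = +a-+b≤+k⇒a≤k+b X (2 * x) 4 (proj₂ bounds)
  }
  where
  U = + X -ᶻ + (2 * x)
  V = + Y -ᶻ + (2 * y)
  cross≡ : ∀ (U V : ℤ) → U *ᶻ + 0 -ᶻ V *ᶻ + 4 ≡ -ᶻ (V *ᶻ + 4)
  cross≡ = solve-∀
  dot≡ : ∀ (U V : ℤ) → U *ᶻ + 4 +ᶻ V *ᶻ + 0 ≡ U *ᶻ + 4
  dot≡ = solve-∀
  bounds = scaled-bounds U 4 (subst (+ 0 ≤ᶻ_) (dot≡ U V) d₁) (subst (_≤ᶻ + 16) (dot≡ U V) d₂)

onSeg⇒onVertical : ∀ X Y x y → OnSeg (+ X , + Y) (dbl (x , y)) (dbl (x , suc (suc y))) →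
                   OnVertical X Y x y
onSeg⇒onVertical X Y x y h
  with onSeg⇒onOffset (+ X , + Y) (dbl (x , y)) (dbl (x , suc (suc y))) (vertical-offset x y) h
... | c , d₁ , d₂ = record
  { x-eq = +a-+b≡0⇒a≡b X (2 * x) (ℤₚ.*-cancelʳ-≡ U (+ 0) (+ 4) (trans (sym (cross≡ U V)) c))
  ; y-lo = 0≤+a-+b⇒b≤a Y (2 * y) (proj₁ bounds)
  ; y-hi = +a-+b≤+k⇒a≤k+b Y (2 * y) 4 (proj₂ bounds)
  }
  where
  U = + X -ᶻ + (2 * x)
  V = + Y -ᶻ + (2 * y)
  cross≡ : ∀ (U V : ℤ) → U *ᶻ + 4 -ᶻ V *ᶻ + 0 ≡ U *ᶻ + 4
  cross≡ = solve-∀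
  dot≡ : ∀ (U V : ℤ) → U *ᶻ + 0 +ᶻ V *ᶻ + 4 ≡ V *ᶻ + 4
  dot≡ = solve-∀
  bounds = scaled-bounds V 4 (subst (+ 0 ≤ᶻ_) (dot≡ U V) d₁) (subst (_≤ᶻ + 16) (dot≡ U V) d₂)

onSeg⇒onDiagonal : ∀ X Y x y → OnSeg (+ X , + Y) (dbl (x , y)) (dbl (suc x , suc y)) →
                   OnDiagonal X Y x y
onSeg⇒onDiagonal X Y x y h
  with onSeg⇒onOffset (+ X , + Y) (dbl (x , y)) (dbl (suc x , suc y)) (diagonal-offset x y) h
... | c , d₁ , d₂ = record
  { xy-eq = +a-+b≡+c-+d⇒a+d≡c+b X (2 * x) Y (2 * y) U≡V
  ; x-lo = 0≤+a-+b⇒b≤a X (2 * x) (proj₁ bounds)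
  ; x-hi = +a-+b≤+k⇒a≤k+b X (2 * x) 2 (proj₂ bounds)
  }
  where
  U = + X -ᶻ + (2 * x)
  V = + Y -ᶻ + (2 * y)
  cross≡ : ∀ (U V : ℤ) → U *ᶻ + 2 -ᶻ V *ᶻ + 2 ≡ (U -ᶻ V) *ᶻ + 2
  cross≡ = solve-∀
  U≡V : U ≡ V
  U≡V = ℤₚ.i-j≡0⇒i≡j U V (ℤₚ.*-cancelʳ-≡ (U -ᶻ V) (+ 0) (+ 2) (trans (sym (cross≡ U V)) c))
  dot≡ : ∀ (U : ℤ) → U *ᶻ + 2 +ᶻ U *ᶻ + 2 ≡ U *ᶻ + 4
  dot≡ = solve-∀
  dot-scaled : U *ᶻ + 2 +ᶻ V *ᶻ + 2 ≡ U *ᶻ + 4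
  dot-scaled = trans (cong (λ t → U *ᶻ + 2 +ᶻ t *ᶻ + 2) (sym U≡V)) (dot≡ U)
  bounds = scaled-bounds U 2 (subst (+ 0 ≤ᶻ_) dot-scaled d₁) (subst (_≤ᶻ + 8) dot-scaled d₂)

onSeg⇒onAntidiagonal : ∀ X Y x y → OnSeg (+ X , + Y) (dbl (x , suc y)) (dbl (suc x , y)) →
                       OnAntidiagonal X Y x y
onSeg⇒onAntidiagonal X Y x y h
  with onSeg⇒onOffset (+ X , + Y) (dbl (x , suc y)) (dbl (suc x , y)) (antidiagonal-offset x y) h
... | c , d₁ , d₂ = record
  { xy-eq = +a-+b≡-[+c-+d]⇒a+c≡d+b X (2 * x) Y (2 * suc y) U≡-V
  ; x-lo = 0≤+a-+b⇒b≤a X (2 * x) (proj₁ bounds)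
  ; x-hi = +a-+b≤+k⇒a≤k+b X (2 * x) 2 (proj₂ bounds)
  }
  where
  U = + X -ᶻ + (2 * x)
  V = + Y -ᶻ + (2 * suc y)
  cross≡ : ∀ (U V : ℤ) → U *ᶻ (-ᶻ + 2) -ᶻ V *ᶻ + 2 ≡ (-ᶻ (U +ᶻ V)) *ᶻ + 2
  cross≡ = solve-∀
  solve-U : ∀ (U V : ℤ) → U ≡ (-ᶻ (-ᶻ (U +ᶻ V))) -ᶻ V
  solve-U = solve-∀
  U≡-V : U ≡ -ᶻ V
  U≡-V = trans (solve-U U V) (trans (cong (λ t → -ᶻ t -ᶻ V)
           (ℤₚ.*-cancelʳ-≡ (-ᶻ (U +ᶻ V)) (+ 0) (+ 2) (trans (sym (cross≡ U V)) c)))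
           (ℤₚ.+-identityˡ (-ᶻ V)))
  dot≡ : ∀ (U : ℤ) → U *ᶻ + 2 +ᶻ (-ᶻ U) *ᶻ (-ᶻ + 2) ≡ U *ᶻ + 4
  dot≡ = solve-∀
  dot-scaled : U *ᶻ + 2 +ᶻ V *ᶻ (-ᶻ + 2) ≡ U *ᶻ + 4
  dot-scaled = trans (cong (λ t → U *ᶻ + 2 +ᶻ t *ᶻ (-ᶻ + 2))
          (trans (sym (ℤₚ.neg-involutive V)) (cong -ᶻ_ (sym U≡-V)))) (dot≡ U)
  bounds = scaled-bounds U 2 (subst (+ 0 ≤ᶻ_) dot-scaled d₁) (subst (_≤ᶻ + 8) dot-scaled d₂)

onSeg-sym : ∀ P B₁ B₂ → OnSeg P B₁ B₂ → OnSeg P B₂ B₁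
onSeg-sym (p₁ , p₂) (a₁ , a₂) (c₁ , c₂) (h₁ , h₂ , h₃) =
  trans (cross≡ p₁ p₂ a₁ a₂ c₁ c₂) (cong -ᶻ_ h₁) ,
  subst (+ 0 ≤ᶻ_) (sym (dot≡ p₁ p₂ a₁ a₂ c₁ c₂)) (ℤₚ.i≤j⇒0≤j-i h₃) ,
  subst₂ _≤ᶻ_ (sym (dot≡ p₁ p₂ a₁ a₂ c₁ c₂)) (sym (norm≡ a₁ a₂ c₁ c₂)) (ℤₚ.i-j≤i _ _ {{nonNegative h₂}})
  where
  cross≡ : ∀ p₁ p₂ a₁ a₂ c₁ c₂ →
    (p₁ -ᶻ c₁) *ᶻ (a₂ -ᶻ c₂) -ᶻ (p₂ -ᶻ c₂) *ᶻ (a₁ -ᶻ c₁) ≡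
    -ᶻ ((p₁ -ᶻ a₁) *ᶻ (c₂ -ᶻ a₂) -ᶻ (p₂ -ᶻ a₂) *ᶻ (c₁ -ᶻ a₁))
  cross≡ = solve-∀
  dot≡ : ∀ p₁ p₂ a₁ a₂ c₁ c₂ →
    (p₁ -ᶻ c₁) *ᶻ (a₁ -ᶻ c₁) +ᶻ (p₂ -ᶻ c₂) *ᶻ (a₂ -ᶻ c₂) ≡
    ((c₁ -ᶻ a₁) *ᶻ (c₁ -ᶻ a₁) +ᶻ (c₂ -ᶻ a₂) *ᶻ (c₂ -ᶻ a₂)) -ᶻ
    ((p₁ -ᶻ a₁) *ᶻ (c₁ -ᶻ a₁) +ᶻ (p₂ -ᶻ a₂) *ᶻ (c₂ -ᶻ a₂))
  dot≡ = solve-∀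
  norm≡ : ∀ a₁ a₂ c₁ c₂ → (a₁ -ᶻ c₁) *ᶻ (a₁ -ᶻ c₁) +ᶻ (a₂ -ᶻ c₂) *ᶻ (a₂ -ᶻ c₂) ≡
                          (c₁ -ᶻ a₁) *ᶻ (c₁ -ᶻ a₁) +ᶻ (c₂ -ᶻ a₂) *ᶻ (c₂ -ᶻ a₂)
  norm≡ = solve-∀

-- Colours

private
  even⇒¬even-suc : ∀ k → k % 2 ≡ 0 → ¬ suc k % 2 ≡ 0
  even⇒¬even-suc (suc zero) () _
  even⇒¬even-suc (suc (suc k)) e e′ = even⇒¬even-suc k e e′

  even⇒odd-suc : ∀ k → k % 2 ≡ 0 → suc k % 2 ≡ 1
  even⇒odd-suc zero _ = refl
  even⇒odd-suc (suc (suc k)) e = even⇒odd-suc k e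

  even-suc⇒odd : ∀ k → suc k % 2 ≡ 0 → k % 2 ≡ 1
  even-suc⇒odd (suc zero) _ = refl
  even-suc⇒odd (suc (suc k)) e = even-suc⇒odd k e

  odd-suc⇒even : ∀ k → suc k % 2 ≡ 1 → k % 2 ≡ 0
  odd-suc⇒even zero _ = refl
  odd-suc⇒even (suc (suc k)) o = odd-suc⇒even k o

  odd⇒even-suc : ∀ k → k % 2 ≡ 1 → suc k % 2 ≡ 0
  odd⇒even-suc (suc zero) _ = refl
  odd⇒even-suc (suc (suc k)) o = odd⇒even-suc k o

  even-cong : ∀ {k k′} → k ≡ k′ → k % 2 ≡ 0 → k′ % 2 ≡ 0
  even-cong = subst (λ k → k % 2 ≡ 0)

module _ {x y : ℕ} where

  black⇒¬black-right : Black (x , y) → ¬ Black (suc x , y)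
  black⇒¬black-right = even⇒¬even-suc (x + y)

  black⇒¬black-up : Black (x , y) → ¬ Black (x , suc y)
  black⇒¬black-up b b′ = black⇒¬black-right b (even-cong (ℕₚ.+-suc x y) b′)

  black⇒white-right : Black (x , y) → White (suc x , y)
  black⇒white-right = even⇒odd-suc (x + y)

  black⇒white-up : Black (x , y) → White (x , suc y)
  black⇒white-up b = subst (λ k → k % 2 ≡ 1) (sym (ℕₚ.+-suc x y)) (black⇒white-right b)

  black-right⇒white : Black (suc x , y) → White (x , y)
  black-right⇒white = even-suc⇒odd (x + y)

  black-up⇒white : Black (x , suc y) → White (x , y)
  black-up⇒white b = black-right⇒white (even-cong (ℕₚ.+-suc x y) b)

  white-right⇒black : White (suc x , y) → Black (x , y)
  white-right⇒black = odd-suc⇒even (x + y)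

  black-up⇒black-right : Black (x , suc y) → Black (suc x , y)
  black-up⇒black-right = even-cong (ℕₚ.+-suc x y)

  black⇒black-diag : Black (x , y) → Black (suc x , suc y)
  black⇒black-diag = even-cong (cong suc (sym (ℕₚ.+-suc x y)))

  black⇒black-up² : Black (x , y) → Black (x , suc (suc y))
  black⇒black-up² = even-cong (sym (trans (ℕₚ.+-suc x (suc y)) (cong suc (ℕₚ.+-suc x y))))

  black-up²⇒black : Black (x , suc (suc y)) → Black (x , y)
  black-up²⇒black = even-cong (trans (ℕₚ.+-suc x (suc y)) (cong suc (ℕₚ.+-suc x y)))

-- Segments of A_u

OnlyNbrs : ℕ → ℕ → (Point → Bool) → Point → Point → Point → Set
OnlyNbrs m n u w b₁ b₂ = ∀ b → InA m n u b → Nbr w b → b ≡ b₁ ⊎ b ≡ b₂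

OnlyNbrs-sym : ∀ {m n u w b₁ b₂} → OnlyNbrs m n u w b₁ b₂ → OnlyNbrs m n u w b₂ b₁
OnlyNbrs-sym o b b∈A w~b = Data.Sum.swap (o b b∈A w~b)

data Segment (m n : ℕ) (u : Point → Bool) : Point → Point → Set where
  horizontal   : ∀ x y → OnlyNbrs m n u (suc x , y) (x , y) (suc (suc x) , y) →
                 Segment m n u (x , y) (suc (suc x) , y)
  vertical     : ∀ x y → OnlyNbrs m n u (x , suc y) (x , y) (x , suc (suc y)) →
                 Segment m n u (x , y) (x , suc (suc y))
  diagonal     : ∀ x y → Segment m n u (x , y) (suc x , suc y)
  antidiagonal : ∀ x y → Segment m n u (x , suc y) (suc x , y)

private
  ¬perp : ∀ w b₁ b₂ {d₁ d₂} → sub (toℤ² b₁) (toℤ² w) ≡ d₁ → sub (toℤ² b₂) (toℤ² w) ≡ d₂ →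
          dot d₁ d₂ ≡ -ᶻ (+ 1) → ¬ Perp w b₁ b₂
  ¬perp w b₁ b₂ refl refl d p with trans (sym d) p
  ... | ()

  up-down-¬perp : ∀ x y → ¬ Perp (x , suc y) (x , suc (suc y)) (x , y)
  up-down-¬perp x y = ¬perp (x , suc y) (x , suc (suc y)) (x , y)
    (cong₂ _,_ (+[k+a]-+a≡+k 0 x) (+[k+a]-+a≡+k 1 (suc y)))
    (cong₂ _,_ (+[k+a]-+a≡+k 0 x) (+a-+[k+a]≡-+k 1 y)) refl

  right-left-¬perp : ∀ x y → ¬ Perp (suc x , y) (suc (suc x) , y) (x , y)
  right-left-¬perp x y = ¬perp (suc x , y) (suc (suc x) , y) (x , y)
    (cong₂ _,_ (+[k+a]-+a≡+k 1 (suc x)) (+[k+a]-+a≡+k 0 y))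
    (cong₂ _,_ (+a-+[k+a]≡-+k 1 x) (+[k+a]-+a≡+k 0 y)) refl

  down-up-¬perp : ∀ x y → ¬ Perp (x , suc y) (x , y) (x , suc (suc y))
  down-up-¬perp x y = ¬perp (x , suc y) (x , y) (x , suc (suc y))
    (cong₂ _,_ (+[k+a]-+a≡+k 0 x) (+a-+[k+a]≡-+k 1 y))
    (cong₂ _,_ (+[k+a]-+a≡+k 0 x) (+[k+a]-+a≡+k 1 (suc y))) refl

  left-right-¬perp : ∀ x y → ¬ Perp (suc x , y) (x , y) (suc (suc x) , y)
  left-right-¬perp x y = ¬perp (suc x , y) (x , y) (suc (suc x) , y)
    (cong₂ _,_ (+a-+[k+a]≡-+k 1 x) (+[k+a]-+a≡+k 0 y))
    (cong₂ _,_ (+[k+a]-+a≡+k 1 (suc x)) (+[k+a]-+a≡+k 0 y)) refl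

  nonPerp⇒OnlyNbrs : ∀ {m n u w b₁ b₂} → ¬ Perp w b₁ b₂ →
                     Perp w b₁ b₂ ⊎ OnlyNbrs m n u w b₁ b₂ → OnlyNbrs m n u w b₁ b₂
  nonPerp⇒OnlyNbrs ¬p (inj₁ p) = ⊥-elim (¬p p)
  nonPerp⇒OnlyNbrs ¬p (inj₂ o) = o

-- Two neighbours of a white point are either opposite, hence not perpendicular, or diagonal.
adjA⇒segment : ∀ {m n u b₁ b₂} → AdjA m n u b₁ b₂ → Segment m n u b₁ b₂ ⊎ Segment m n u b₂ b₁
adjA⇒segment (_ , _ , b₁≢b₂ , _ , _ , _ , w~b₁ , w~b₂ , po) = classify w~b₁ w~b₂ b₁≢b₂ po
  where
  classify : ∀ {m n u p q x₁ y₁ x₂ y₂} → Nbr (p , q) (x₁ , y₁) → Nbr (p , q) (x₂ , y₂) →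
             (x₁ , y₁) ≢ (x₂ , y₂) →
             Perp (p , q) (x₁ , y₁) (x₂ , y₂) ⊎ OnlyNbrs m n u (p , q) (x₁ , y₁) (x₂ , y₂) →
             Segment m n u (x₁ , y₁) (x₂ , y₂) ⊎ Segment m n u (x₂ , y₂) (x₁ , y₁)
  classify (inj₁ (refl , inj₁ refl)) (inj₁ (refl , inj₁ refl)) ne _ = ⊥-elim (ne refl)
  classify {p = x} {y₂ = y} (inj₁ (refl , inj₁ refl)) (inj₁ (refl , inj₂ refl)) _ po =
    inj₂ (vertical x y (OnlyNbrs-sym (nonPerp⇒OnlyNbrs (up-down-¬perp x y) po)))
  classify (inj₁ (refl , inj₁ refl)) (inj₂ (refl , inj₁ refl)) _ _ = inj₁ (antidiagonal _ _)
  classify (inj₁ (refl , inj₁ refl)) (inj₂ (refl , inj₂ refl)) _ _ = inj₂ (diagonal _ _)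
  classify {p = x} {y₁ = y} (inj₁ (refl , inj₂ refl)) (inj₁ (refl , inj₁ refl)) _ po =
    inj₁ (vertical x y (nonPerp⇒OnlyNbrs (down-up-¬perp x y) po))
  classify (inj₁ (refl , inj₂ refl)) (inj₁ (refl , inj₂ refl)) ne _ = ⊥-elim (ne refl)
  classify (inj₁ (refl , inj₂ refl)) (inj₂ (refl , inj₁ refl)) _ _ = inj₁ (diagonal _ _)
  classify (inj₁ (refl , inj₂ refl)) (inj₂ (refl , inj₂ refl)) _ _ = inj₂ (antidiagonal _ _)
  classify (inj₂ (refl , inj₁ refl)) (inj₁ (refl , inj₁ refl)) _ _ = inj₂ (antidiagonal _ _)
  classify (inj₂ (refl , inj₁ refl)) (inj₁ (refl , inj₂ refl)) _ _ = inj₂ (diagonal _ _)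
  classify (inj₂ (refl , inj₁ refl)) (inj₂ (refl , inj₁ refl)) ne _ = ⊥-elim (ne refl)
  classify {q = y} {x₂ = x} (inj₂ (refl , inj₁ refl)) (inj₂ (refl , inj₂ refl)) _ po =
    inj₂ (horizontal x y (OnlyNbrs-sym (nonPerp⇒OnlyNbrs (right-left-¬perp x y) po)))
  classify (inj₂ (refl , inj₂ refl)) (inj₁ (refl , inj₁ refl)) _ _ = inj₁ (diagonal _ _)
  classify (inj₂ (refl , inj₂ refl)) (inj₁ (refl , inj₂ refl)) _ _ = inj₁ (antidiagonal _ _)
  classify {q = y} {x₁ = x} (inj₂ (refl , inj₂ refl)) (inj₂ (refl , inj₁ refl)) _ po =
    inj₁ (horizontal x y (nonPerp⇒OnlyNbrs (left-right-¬perp x y) po))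
  classify (inj₂ (refl , inj₂ refl)) (inj₂ (refl , inj₂ refl)) ne _ = ⊥-elim (ne refl)

record CoveringSegment (m n : ℕ) (u : Point → Bool) (P Q : Point) : Set where
  field
    {start end} : Point
    start∈A     : InA m n u start
    end∈A       : InA m n u end
    segment     : Segment m n u start end
    P∈segment   : OnSeg (toℤ² P) (dbl start) (dbl end)
    Q∈segment   : OnSeg (toℤ² Q) (dbl start) (dbl end)

covered⇒coveringSegment : ∀ {m n u P Q} → Covered m n u P Q → CoveringSegment m n u P Q
covered⇒coveringSegment {P = P} {Q} (b₁ , b₂ , adj@(b₁∈A , b₂∈A , _) , P∈ , Q∈) with adjA⇒segment adj
... | inj₁ s = record { start∈A = b₁∈A ; end∈A = b₂∈A ; segment = s ; P∈segment = P∈ ; Q∈segment = Q∈ }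
... | inj₂ s = record { start∈A = b₂∈A ; end∈A = b₁∈A ; segment = s
                      ; P∈segment = onSeg-sym (toℤ² P) (dbl b₁) (dbl b₂) P∈
                      ; Q∈segment = onSeg-sym (toℤ² Q) (dbl b₁) (dbl b₂) Q∈ }

private
  n≢2+n : ∀ k → k ≢ 2 + k
  n≢2+n k = ℕₚ.m≢1+n+m k {1}

  odd≢even : ∀ a b → suc (2 * a) ≢ 2 * b
  odd≢even a zero ()
  odd≢even zero (suc b) e = ℕₚ.0≢1+n (ℕₚ.suc-injective (trans e (2*[1+x]≡2+2*x b)))
  odd≢even (suc a) (suc b) e = odd≢even a b (ℕₚ.suc-injective (ℕₚ.suc-injective
    (trans (cong suc (sym (2*[1+x]≡2+2*x a))) (trans e (2*[1+x]≡2+2*x b)))))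

  even≤odd⇒≤ : ∀ a b → 2 * a ≤ suc (2 * b) → a ≤ b
  even≤odd⇒≤ zero b _ = z≤n
  even≤odd⇒≤ (suc a) zero (s≤s h) with subst (_≤ 0) (ℕₚ.+-suc a (a + 0)) h
  ... | ()
  even≤odd⇒≤ (suc a) (suc b) h = s≤s (even≤odd⇒≤ a b (ℕₚ.≤-pred (ℕₚ.≤-pred
    (subst₂ _≤_ (2*[1+x]≡2+2*x a) (cong suc (2*[1+x]≡2+2*x b)) h))))

  half-≤ : ∀ a b → 2 * a ≤ 2 * b → a ≤ b
  half-≤ a b = ℕₚ.*-cancelˡ-≤ 2

  half-≡ : ∀ a b → 2 * a ≡ 2 * b → a ≡ b
  half-≡ a b = ℕₚ.*-cancelˡ-≡ a b 2

  centre-x : ∀ i x → 2 * x ≤ suc (2 * i) → suc (2 * i) ≤ 2 + 2 * x → x ≡ i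
  centre-x i x lo hi = ℕₚ.≤-antisym (even≤odd⇒≤ x i lo) (even≤odd⇒≤ i x (ℕₚ.≤-pred hi))

  diagonal-through-centre : ∀ i j x y → OnDiagonal (suc (2 * i)) (suc (2 * j)) x y → x ≡ i × y ≡ j
  diagonal-through-centre i j x y record { xy-eq = e ; x-lo = lo ; x-hi = hi }
    with centre-x i x lo hi
  ... | refl = refl , half-≡ y j (ℕₚ.+-cancelˡ-≡ (suc (2 * i)) (2 * y) (2 * j) (trans e (rearrange i j)))
    where
    rearrange : ∀ i j → suc (2 * j) + 2 * i ≡ suc (2 * i) + 2 * j
    rearrange = ℕ-solve-∀

  antidiagonal-through-centre : ∀ i j x y → OnAntidiagonal (suc (2 * i)) (suc (2 * j)) x y →
                                x ≡ i × y ≡ j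
  antidiagonal-through-centre i j x y record { xy-eq = e ; x-lo = lo ; x-hi = hi }
    with centre-x i x lo hi
  ... | refl = refl , sym (half-≡ j y (ℕₚ.+-cancelˡ-≡ (2 + 2 * i) (2 * j) (2 * y)
                 (trans (sym (rearrange i j)) (trans e (rearrange′ i y)))))
    where
    rearrange : ∀ i j → suc (2 * i) + suc (2 * j) ≡ 2 + 2 * i + 2 * j
    rearrange = ℕ-solve-∀
    rearrange′ : ∀ i y → 2 * suc y + 2 * i ≡ 2 + 2 * i + 2 * y
    rearrange′ = ℕ-solve-∀

data CentreCover (m n : ℕ) (u : Point → Bool) (i j : ℕ) (Q : Point) : Set where
  through-diagonal     : InA m n u (i , j) → InA m n u (suc i , suc j) →
                         OnDiagonal (proj₁ Q) (proj₂ Q) i j → CentreCover m n u i j Q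
  through-antidiagonal : InA m n u (i , suc j) → InA m n u (suc i , j) →
                         OnAntidiagonal (proj₁ Q) (proj₂ Q) i j → CentreCover m n u i j Q

-- The centre of a unit square has odd doubled coordinates, so only its two diagonals pass through it.
covered-centre : ∀ {m n u} i j Q → Covered m n u (ctr i j) Q → CentreCover m n u i j Q
covered-centre {m} {n} {u} i j Q = classify ∘ covered⇒coveringSegment
  where
  diagonal-cover : ∀ {x y} → x ≡ i × y ≡ j → InA m n u (x , y) → InA m n u (suc x , suc y) →
                   OnDiagonal (proj₁ Q) (proj₂ Q) x y → CentreCover m n u i j Q
  diagonal-cover (refl , refl) = through-diagonal

  antidiagonal-cover : ∀ {x y} → x ≡ i × y ≡ j → InA m n u (x , suc y) → InA m n u (suc x , y) →
                       OnAntidiagonal (proj₁ Q) (proj₂ Q) x y → CentreCover m n u i j Q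
  antidiagonal-cover (refl , refl) = through-antidiagonal

  classify : CoveringSegment m n u (ctr i j) Q → CentreCover m n u i j Q
  classify record { segment = horizontal x y _ ; P∈segment = P∈ } =
    ⊥-elim (odd≢even j y (OnHorizontal.y-eq (onSeg⇒onHorizontal _ _ x y P∈)))
  classify record { segment = vertical x y _ ; P∈segment = P∈ } =
    ⊥-elim (odd≢even i x (OnVertical.x-eq (onSeg⇒onVertical _ _ x y P∈)))
  classify record { start∈A = s∈A ; end∈A = e∈A ; segment = diagonal x y
                  ; P∈segment = P∈ ; Q∈segment = Q∈ } =
    diagonal-cover (diagonal-through-centre i j x y (onSeg⇒onDiagonal _ _ x y P∈)) s∈A e∈A
                   (onSeg⇒onDiagonal _ _ x y Q∈)
  classify record { start∈A = s∈A ; end∈A = e∈A ; segment = antidiagonal x y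
                  ; P∈segment = P∈ ; Q∈segment = Q∈ } =
    antidiagonal-cover (antidiagonal-through-centre i j x y (onSeg⇒onAntidiagonal _ _ x y P∈)) s∈A e∈A
                       (onSeg⇒onAntidiagonal _ _ x y Q∈)

module _ {m n : ℕ} {u : Point → Bool} (i j : ℕ) where

  covered-centre-SW : Covered m n u (ctr i j) (cor i j) → InA m n u (i , j) × InA m n u (suc i , suc j)
  covered-centre-SW cv with covered-centre i j _ cv
  ... | through-diagonal a b _ = a , b
  ... | through-antidiagonal _ _ record { xy-eq = e } = ⊥-elim (n≢2+n _ (trans e (shift i j)))
    where
    shift : ∀ i j → 2 * suc j + 2 * i ≡ 2 + (2 * i + 2 * j)
    shift = ℕ-solve-∀

  covered-centre-SE : Covered m n u (ctr i j) (cor (suc i) j) →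
                      InA m n u (i , suc j) × InA m n u (suc i , j)
  covered-centre-SE cv with covered-centre i j _ cv
  ... | through-antidiagonal a b _ = a , b
  ... | through-diagonal _ _ record { xy-eq = e } = ⊥-elim (n≢2+n _ (sym (trans (sym (shift i j)) e)))
    where
    shift : ∀ i j → 2 * suc i + 2 * j ≡ 2 + (2 * j + 2 * i)
    shift = ℕ-solve-∀

  covered-centre-NE : Covered m n u (ctr i j) (cor (suc i) (suc j)) →
                      InA m n u (i , j) × InA m n u (suc i , suc j)
  covered-centre-NE cv with covered-centre i j _ cv
  ... | through-diagonal a b _ = a , b
  ... | through-antidiagonal _ _ record { xy-eq = e } = ⊥-elim (n≢2+n _ (sym (trans (sym (shift i j)) e)))
    where
    shift : ∀ i j → 2 * suc i + 2 * suc j ≡ 2 + (2 * suc j + 2 * i)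
    shift = ℕ-solve-∀

  covered-centre-NW : Covered m n u (ctr i j) (cor i (suc j)) →
                      InA m n u (i , suc j) × InA m n u (suc i , j)
  covered-centre-NW cv with covered-centre i j _ cv
  ... | through-antidiagonal a b _ = a , b
  ... | through-diagonal _ _ record { xy-eq = e } = ⊥-elim (n≢2+n _ (trans e (shift i j)))
    where
    shift : ∀ i j → 2 * suc j + 2 * i ≡ 2 + (2 * i + 2 * j)
    shift = ℕ-solve-∀

record HSegment (m n : ℕ) (u : Point → Bool) (x y : ℕ) : Set where
  field
    left∈A  : InA m n u (x , y)
    right∈A : InA m n u (suc (suc x) , y)
    only    : OnlyNbrs m n u (suc x , y) (x , y) (suc (suc x) , y)

record VSegment (m n : ℕ) (u : Point → Bool) (x y : ℕ) : Set where
  field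
    bottom∈A : InA m n u (x , y)
    top∈A    : InA m n u (x , suc (suc y))
    only     : OnlyNbrs m n u (x , suc y) (x , y) (x , suc (suc y))

data HEdgeCover (m n : ℕ) (u : Point → Bool) : ℕ → ℕ → Set where
  first-half  : ∀ {x y} → HSegment m n u x y → HEdgeCover m n u x y
  second-half : ∀ {x y} → HSegment m n u x y → HEdgeCover m n u (suc x) y

data VEdgeCover (m n : ℕ) (u : Point → Bool) : ℕ → ℕ → Set where
  first-half  : ∀ {x y} → VSegment m n u x y → VEdgeCover m n u x y
  second-half : ∀ {x y} → VSegment m n u x y → VEdgeCover m n u x (suc y)

private
  between : ∀ {a b} → a ≤ b → b ≤ suc a → b ≡ a ⊎ b ≡ suc a
  between {a} {b} a≤b b≤1+a with b ℕₚ.≟ suc a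
  ... | yes e = inj₂ e
  ... | no ne = inj₁ (ℕₚ.≤-antisym (ℕₚ.m<1+n⇒m≤n (ℕₚ.≤∧≢⇒< b≤1+a ne)) a≤b)

  shift-pair : ∀ a b → 2 * suc a + b ≡ 2 + (2 * a + b)
  shift-pair a b = cong (_+ b) (2*[1+x]≡2+2*x a)

private
  horizontal-cover : ∀ {m n u x y x₀ y₀} → y ≡ y₀ → x ≡ x₀ ⊎ x ≡ suc x₀ → HSegment m n u x₀ y₀ →
                     HEdgeCover m n u x y
  horizontal-cover refl (inj₁ refl) = first-half
  horizontal-cover refl (inj₂ refl) = second-half

  vertical-cover : ∀ {m n u x y x₀ y₀} → x ≡ x₀ → y ≡ y₀ ⊎ y ≡ suc y₀ → VSegment m n u x₀ y₀ →
                   VEdgeCover m n u x y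
  vertical-cover refl (inj₁ refl) = first-half
  vertical-cover refl (inj₂ refl) = second-half

covered-hedge : ∀ {m n u} x y → Covered m n u (cor x y) (cor (suc x) y) → HEdgeCover m n u x y
covered-hedge {m} {n} {u} x y = classify ∘ covered⇒coveringSegment
  where
  classify : CoveringSegment m n u (cor x y) (cor (suc x) y) → HEdgeCover m n u x y
  classify record { segment = vertical x₀ y₀ _ ; P∈segment = P∈ ; Q∈segment = Q∈ } =
    ⊥-elim (n≢2+n (2 * x) (trans (trans (OnVertical.x-eq (onSeg⇒onVertical _ _ x₀ y₀ P∈))
      (sym (OnVertical.x-eq (onSeg⇒onVertical _ _ x₀ y₀ Q∈)))) (2*[1+x]≡2+2*x x)))
  classify record { segment = diagonal x₀ y₀ ; P∈segment = P∈ ; Q∈segment = Q∈ } =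
    ⊥-elim (n≢2+n _ (trans (trans (OnDiagonal.xy-eq (onSeg⇒onDiagonal _ _ x₀ y₀ P∈))
      (sym (OnDiagonal.xy-eq (onSeg⇒onDiagonal _ _ x₀ y₀ Q∈)))) (shift-pair x (2 * y₀))))
  classify record { segment = antidiagonal x₀ y₀ ; P∈segment = P∈ ; Q∈segment = Q∈ } =
    ⊥-elim (n≢2+n _ (trans (trans (OnAntidiagonal.xy-eq (onSeg⇒onAntidiagonal _ _ x₀ y₀ P∈))
      (sym (OnAntidiagonal.xy-eq (onSeg⇒onAntidiagonal _ _ x₀ y₀ Q∈)))) (shift-pair x (2 * y))))
  classify record { start∈A = s∈A ; end∈A = e∈A ; segment = horizontal x₀ y₀ o
                  ; P∈segment = P∈ ; Q∈segment = Q∈ } =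
    horizontal-cover (half-≡ y y₀ (OnHorizontal.y-eq P))
      (between (half-≤ x₀ x (OnHorizontal.x-lo P))
               (ℕₚ.≤-pred (half-≤ (suc x) (suc (suc x₀))
                 (subst (2 * suc x ≤_) (sym (2*[2+x]≡4+2*x x₀)) (OnHorizontal.x-hi Q)))))
      (record { left∈A = s∈A ; right∈A = e∈A ; only = o })
    where
    P = onSeg⇒onHorizontal _ _ x₀ y₀ P∈
    Q = onSeg⇒onHorizontal _ _ x₀ y₀ Q∈

covered-vedge : ∀ {m n u} x y → Covered m n u (cor x y) (cor x (suc y)) → VEdgeCover m n u x y
covered-vedge {m} {n} {u} x y = classify ∘ covered⇒coveringSegment
  where
  classify : CoveringSegment m n u (cor x y) (cor x (suc y)) → VEdgeCover m n u x y
  classify record { segment = horizontal x₀ y₀ _ ; P∈segment = P∈ ; Q∈segment = Q∈ } =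
    ⊥-elim (n≢2+n (2 * y) (trans (trans (OnHorizontal.y-eq (onSeg⇒onHorizontal _ _ x₀ y₀ P∈))
      (sym (OnHorizontal.y-eq (onSeg⇒onHorizontal _ _ x₀ y₀ Q∈)))) (2*[1+x]≡2+2*x y)))
  classify record { segment = diagonal x₀ y₀ ; P∈segment = P∈ ; Q∈segment = Q∈ } =
    ⊥-elim (n≢2+n _ (trans (trans (sym (OnDiagonal.xy-eq (onSeg⇒onDiagonal _ _ x₀ y₀ P∈)))
      (OnDiagonal.xy-eq (onSeg⇒onDiagonal _ _ x₀ y₀ Q∈))) (shift-pair y (2 * x₀))))
  classify record { segment = antidiagonal x₀ y₀ ; P∈segment = P∈ ; Q∈segment = Q∈ } =
    ⊥-elim (n≢2+n _ (trans (trans (OnAntidiagonal.xy-eq (onSeg⇒onAntidiagonal _ _ x₀ y₀ P∈))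
      (sym (OnAntidiagonal.xy-eq (onSeg⇒onAntidiagonal _ _ x₀ y₀ Q∈)))) (shift x y)))
    where
    shift : ∀ x y → 2 * x + 2 * suc y ≡ 2 + (2 * x + 2 * y)
    shift = ℕ-solve-∀
  classify record { start∈A = s∈A ; end∈A = e∈A ; segment = vertical x₀ y₀ o
                  ; P∈segment = P∈ ; Q∈segment = Q∈ } =
    vertical-cover (half-≡ x x₀ (OnVertical.x-eq P))
      (between (half-≤ y₀ y (OnVertical.y-lo P))
               (ℕₚ.≤-pred (half-≤ (suc y) (suc (suc y₀))
                 (subst (2 * suc y ≤_) (sym (2*[2+x]≡4+2*x y₀)) (OnVertical.y-hi Q)))))
      (record { bottom∈A = s∈A ; top∈A = e∈A ; only = o })
    where
    P = onSeg⇒onVertical _ _ x₀ y₀ P∈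
    Q = onSeg⇒onVertical _ _ x₀ y₀ Q∈

-- The kernel condition

χ : ℕ → ℕ → (Point → Bool) → Point → Bool
χ m n u b = inGᵇ m n b ∧ u b

parity : List Bool → Bool
parity = foldr _xor_ false

length-filterᵇ-parity : ∀ {A : Set} (f : A → Bool) xs →
                        length (filterᵇ f xs) % 2 ≡ (if parity (map f xs) then 1 else 0)
length-filterᵇ-parity f [] = refl
length-filterᵇ-parity f (x ∷ xs) with f x
... | false = length-filterᵇ-parity f xs
... | true with parity (map f xs) | length-filterᵇ-parity f xs
...   | false | h = even⇒odd-suc (length (filterᵇ f xs)) h
...   | true  | h = odd⇒even-suc (length (filterᵇ f xs)) h

module Aᵤ {m n : ℕ} {u : Point → Bool} where

  kernel-parity : ∀ {w} → InKerBW m n u → InG m n w → White w →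
                  parity (map (χ m n u) (latticeNbrs w)) ≡ false
  kernel-parity {w} K w∈G w-white
    with parity (map (χ m n u) (latticeNbrs w)) | length-filterᵇ-parity (χ m n u) (latticeNbrs w)
  ... | false | _ = refl
  ... | true  | h with trans (sym (K w w∈G w-white)) h
  ...   | ()

  -- χ at the left and at the lower neighbour; false on the axes, where latticeNbrs omits them
  χ← : Point → Bool
  χ← (zero , _) = false
  χ← (suc x , y) = χ m n u (x , y)

  χ↓ : Point → Bool
  χ↓ (_ , zero) = false
  χ↓ (x , suc y) = χ m n u (x , y)

  kernel-at : ∀ {x y} → InKerBW m n u → InG m n (x , y) → White (x , y) →
              χ m n u (suc x , y) xor (χ m n u (x , suc y) xor (χ← (x , y) xor χ↓ (x , y))) ≡ false
  kernel-at {x} {y} K w∈G white = trans (sym (neighbours x y)) (kernel-parity K w∈G white)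
    where
    neighbours : ∀ x y → parity (map (χ m n u) (latticeNbrs (x , y))) ≡
                         χ m n u (suc x , y) xor (χ m n u (x , suc y) xor (χ← (x , y) xor χ↓ (x , y)))
    neighbours zero    zero    = refl
    neighbours zero    (suc y) = cong (λ t → χ m n u (1 , suc y) xor (χ m n u (0 , suc (suc y)) xor t))
                                       (𝔹.xor-identityʳ (χ m n u (0 , y)))
    neighbours (suc x) zero    = refl
    neighbours (suc x) (suc y) =
      cong (λ t → χ m n u (suc (suc x) , suc y) xor
                    (χ m n u (suc x , suc (suc y)) xor (χ m n u (x , suc y) xor t)))
           (𝔹.xor-identityʳ (χ m n u (suc x , y)))

  inA⇒¬inA-right : ∀ {x y} → InA m n u (x , y) → ¬ InA m n u (suc x , y)
  inA⇒¬inA-right {x} {y} a a′ = black⇒¬black-right {x} {y} (proj₁ (proj₂ a)) (proj₁ (proj₂ a′))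

  inA⇒¬inA-up : ∀ {x y} → InA m n u (x , y) → ¬ InA m n u (x , suc y)
  inA⇒¬inA-up {x} {y} a a′ = black⇒¬black-up {x} {y} (proj₁ (proj₂ a)) (proj₁ (proj₂ a′))

  T-inG⇒InG : ∀ {b} → T (inGᵇ m n b) → InG m n b
  T-inG⇒InG {x , y} t with Equivalence.to 𝔹.T-∧ t
  ... | tx , ty = ℕₚ.<ᵇ⇒< x m tx , ℕₚ.<ᵇ⇒< y n ty

  InG⇒T-inG : ∀ {b} → InG m n b → T (inGᵇ m n b)
  InG⇒T-inG (x<m , y<n) = Equivalence.from 𝔹.T-∧ (ℕₚ.<⇒<ᵇ x<m , ℕₚ.<⇒<ᵇ y<n)

  inA⇒χ≡true : ∀ {b} → InA m n u b → χ m n u b ≡ true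
  inA⇒χ≡true (b∈G , _ , ub) =
    Equivalence.to 𝔹.T-≡ (Equivalence.from 𝔹.T-∧ (InG⇒T-inG b∈G , Equivalence.from 𝔹.T-≡ ub))

  χ≡true⇒inA : ∀ {b} → Black b → χ m n u b ≡ true → InA m n u b
  χ≡true⇒inA black e with Equivalence.to 𝔹.T-∧ (Equivalence.from 𝔹.T-≡ e)
  ... | b∈G , ub = T-inG⇒InG b∈G , black , Equivalence.to 𝔹.T-≡ ub

  χ≡false⇒¬inA : ∀ {b} → χ m n u b ≡ false → ¬ InA m n u b
  χ≡false⇒¬inA e b∈A with trans (sym e) (inA⇒χ≡true b∈A)
  ... | ()

  ¬inA⇒χ≡false : ∀ {b} → Black b → ¬ InA m n u b → χ m n u b ≡ false
  ¬inA⇒χ≡false {b} black b∉A with χ m n u b in e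
  ... | true  = ⊥-elim (b∉A (χ≡true⇒inA black e))
  ... | false = refl

  χ←≡false : ∀ {x y} → White (x , y) → (∀ x′ → suc x′ ≡ x → ¬ InA m n u (x′ , y)) → χ← (x , y) ≡ false
  χ←≡false {zero} _ _ = refl
  χ←≡false {suc x} {y} white ¬left = ¬inA⇒χ≡false (white-right⇒black {x} {y} white) (¬left x refl)

  χ↓≡false⇒¬inA : ∀ {x y} → χ↓ (x , y) ≡ false → ∀ y′ → suc y′ ≡ y → ¬ InA m n u (x , y′)
  χ↓≡false⇒¬inA {y = suc y} e _ refl = χ≡false⇒¬inA e

  InA? : ∀ b → Dec (InA m n u b)
  InA? (x , y) = ((x <? m) ×-dec (y <? n)) ×-dec (((x + y) % 2 ℕₚ.≟ 0) ×-dec (u (x , y) 𝔹.≟ true))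

  OnlyNbrs-stable : ∀ {w b₁ b₂} → ¬ ¬ OnlyNbrs m n u w b₁ b₂ → OnlyNbrs m n u w b₁ b₂
  OnlyNbrs-stable {w} {b₁} {b₂} ¬¬o b b∈A w~b with (b ≟ₚ b₁) ⊎-dec (b ≟ₚ b₂)
    where _≟ₚ_ = ≡-dec ℕₚ._≟_ ℕₚ._≟_
  ... | yes p = p
  ... | no ¬p = ⊥-elim (¬¬o (λ o → ¬p (o b b∈A w~b)))

  -- Covered is not decidable but segments are, so an edge can be shown covered by contradiction.
  VSegment-stable : ∀ {x y} → ¬ ¬ VSegment m n u x y → VSegment m n u x y
  VSegment-stable ¬¬s = record
    { bottom∈A = decidable-stable (InA? _) (λ ¬a → ¬¬s (¬a ∘ VSegment.bottom∈A))
    ; top∈A    = decidable-stable (InA? _) (λ ¬a → ¬¬s (¬a ∘ VSegment.top∈A))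
    ; only     = OnlyNbrs-stable (λ ¬o → ¬¬s (¬o ∘ VSegment.only))
    }

  above-midpoint∉A : ∀ {x y} → HSegment m n u x y → ¬ InA m n u (suc x , suc y)
  above-midpoint∉A s b∈A = [ ℕₚ.1+n≢n ∘ cong proj₁ , ℕₚ.1+n≢n ∘ cong proj₂ ]′
    (HSegment.only s _ b∈A (inj₁ (refl , inj₁ refl)))

  below-midpoint∉A : ∀ {x y} → HSegment m n u x (suc y) → ¬ InA m n u (suc x , y)
  below-midpoint∉A s b∈A = [ ℕₚ.1+n≢n ∘ cong proj₁ , ℕₚ.1+n≢n ∘ sym ∘ cong proj₂ ]′
    (HSegment.only s _ b∈A (inj₁ (refl , inj₂ refl)))

  midpoint-vedge-above-uncovered : ∀ {x y} → HSegment m n u x y →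
                                   ¬ Covered m n u (cor (suc x) y) (cor (suc x) (suc y))
  midpoint-vedge-above-uncovered s cv with covered-vedge _ _ cv
  ... | first-half t = inA⇒¬inA-right (HSegment.left∈A s) (VSegment.bottom∈A t)
  ... | second-half t = above-midpoint∉A s (VSegment.top∈A t)

  midpoint-vedge-below-uncovered : ∀ {x y} → HSegment m n u x (suc y) →
                                   ¬ Covered m n u (cor (suc x) y) (cor (suc x) (suc y))
  midpoint-vedge-below-uncovered s cv with covered-vedge _ _ cv
  ... | first-half t = below-midpoint∉A s (VSegment.bottom∈A t)
  ... | second-half t = inA⇒¬inA-right (HSegment.left∈A s) (VSegment.top∈A t)

  covered-hedge-from-A : ∀ {x y} → InA m n u (x , y) →
                         Covered m n u (cor x y) (cor (suc x) y) → HSegment m n u x y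
  covered-hedge-from-A a cv with covered-hedge _ _ cv
  ... | first-half s = s
  ... | second-half s = ⊥-elim (inA⇒¬inA-right a (HSegment.right∈A s))

  covered-vedge-from-A : ∀ {x y} → InA m n u (x , y) →
                         Covered m n u (cor x y) (cor x (suc y)) → VSegment m n u x y
  covered-vedge-from-A a cv with covered-vedge _ _ cv
  ... | first-half s = s
  ... | second-half s = ⊥-elim (inA⇒¬inA-up a (VSegment.top∈A s))

  covered-vedge-to-A : ∀ {x y} → InA m n u (x , suc (suc y)) →
                       Covered m n u (cor x (suc y)) (cor x (suc (suc y))) → VSegment m n u x y
  covered-vedge-to-A a cv with covered-vedge _ _ cv
  ... | first-half s = ⊥-elim (inA⇒¬inA-up (VSegment.bottom∈A s) a)
  ... | second-half s = s

  onlyNbrs-by-direction : ∀ {x y b₁ b₂} →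
    (InA m n u (x , suc y) → (x , suc y) ≡ b₁ ⊎ (x , suc y) ≡ b₂) →
    (∀ y′ → suc y′ ≡ y → InA m n u (x , y′) → (x , y′) ≡ b₁ ⊎ (x , y′) ≡ b₂) →
    (InA m n u (suc x , y) → (suc x , y) ≡ b₁ ⊎ (suc x , y) ≡ b₂) →
    (∀ x′ → suc x′ ≡ x → InA m n u (x′ , y) → (x′ , y) ≡ b₁ ⊎ (x′ , y) ≡ b₂) →
    OnlyNbrs m n u (x , y) b₁ b₂
  onlyNbrs-by-direction up down right left _ b∈A (inj₁ (refl , inj₁ refl)) = up b∈A
  onlyNbrs-by-direction up down right left (_ , y′) b∈A (inj₁ (refl , inj₂ e)) = down y′ e b∈A
  onlyNbrs-by-direction up down right left _ b∈A (inj₂ (refl , inj₁ refl)) = right b∈A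
  onlyNbrs-by-direction up down right left (x′ , _) b∈A (inj₂ (refl , inj₂ e)) = left x′ e b∈A

ExactlyCount-⊆ : ∀ {P L k xs} → ExactlyCount P L k → xs ⊆ L → All P xs → length xs ≤ k
ExactlyCount-⊆ ec[] [] [] = z≤n
ExactlyCount-⊆ (ecYes _ ec) (refl ∷ s) (_ ∷ ps) = s≤s (ExactlyCount-⊆ ec s ps)
ExactlyCount-⊆ (ecYes _ ec) (_ ∷ʳ s) ps = ℕₚ.m≤n⇒m≤1+n (ExactlyCount-⊆ ec s ps)
ExactlyCount-⊆ (ecNo ¬p _) (refl ∷ _) (p ∷ _) = ⊥-elim (¬p p)
ExactlyCount-⊆ (ecNo _ ec) (_ ∷ʳ s) ps = ExactlyCount-⊆ ec s ps

three-cells⇒¬rightAngle : ∀ {C : Cell → Set} {x y c₁ c₂ c₃} → (c₁ ∷ c₂ ∷ c₃ ∷ []) ⊆ cornerCells x y →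
                          C c₁ → C c₂ → C c₃ → ¬ RightAngleAt C x y
three-cells⇒¬rightAngle s c₁ c₂ c₃ ra with ExactlyCount-⊆ ra s (c₁ ∷ c₂ ∷ c₃ ∷ [])
... | s≤s (s≤s ())

-- Chunks

module _ {m n : ℕ} {u : Point → Bool} where

  Path : Cell → Cell → Set
  Path = Star (SymClosure (Link m n u))

  path-reverse : ∀ {c c′} → Path c c′ → Path c′ c
  path-reverse = reverse (symmetric (Link m n u))

  link-valid : ∀ {c c′} → Link m n u c c′ → ValidCell m n c × ValidCell m n c′
  link-valid (lSE v _) = v , v
  link-valid (lEN v _) = v , v
  link-valid (lNW v _) = v , v
  link-valid (lWS v _) = v , v
  link-valid (lNS v v′ _) = v , v′
  link-valid (lEW v v′ _) = v , v′

  path-valid : ∀ {c c′} → ValidCell m n c → Path c c′ → ValidCell m n c′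
  path-valid v ε = v
  path-valid v (fwd l ◅ p) = path-valid (proj₂ (link-valid l)) p
  path-valid v (bwd l ◅ p) = path-valid (proj₁ (link-valid l)) p

  chunk-fwd : ∀ {c₀ c c′} → Chunk m n u c₀ c → Link m n u c c′ → Chunk m n u c₀ c′
  chunk-fwd p l = p ◅◅ (fwd l ◅ ε)

  chunk-bwd : ∀ {c₀ c c′} → Chunk m n u c₀ c → Link m n u c′ c → Chunk m n u c₀ c′
  chunk-bwd p l = p ◅◅ (bwd l ◅ ε)

-- Framed squares

module _ {m n : ℕ} {u : Point → Bool} where

  private
    on-horizontal : ∀ k x y → k ≤ 2 → OnSeg (toℤ² (cor (k + x) y)) (dbl (x , y)) (dbl (suc (suc x) , y))
    on-horizontal k x y k≤2 = subst₂ OnOffset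
      (sym (cong₂ _,_ (dbl-offset x k) (+[k+a]-+a≡+k 0 (2 * y)))) (sym (horizontal-offset x y)) (base k k≤2)
      where
      base : ∀ k → k ≤ 2 → OnOffset (+ (2 * k) , + 0) (+ 4 , + 0)
      base 0 _ = refl , +≤+ z≤n , +≤+ z≤n
      base 1 _ = refl , +≤+ z≤n , +≤+ (ℕₚ.m≤m+n 8 8)
      base 2 _ = refl , +≤+ z≤n , +≤+ ℕₚ.≤-refl
      base (suc (suc (suc _))) (s≤s (s≤s ()))

    on-vertical : ∀ k x y → k ≤ 2 → OnSeg (toℤ² (cor x (k + y))) (dbl (x , y)) (dbl (x , suc (suc y)))
    on-vertical k x y k≤2 = subst₂ OnOffset
      (sym (cong₂ _,_ (+[k+a]-+a≡+k 0 (2 * x)) (dbl-offset y k))) (sym (vertical-offset x y)) (base k k≤2)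
      where
      base : ∀ k → k ≤ 2 → OnOffset (+ 0 , + (2 * k)) (+ 0 , + 4)
      base 0 _ = refl , +≤+ z≤n , +≤+ z≤n
      base 1 _ = refl , +≤+ z≤n , +≤+ (ℕₚ.m≤m+n 8 8)
      base 2 _ = refl , +≤+ z≤n , +≤+ ℕₚ.≤-refl
      base (suc (suc (suc _))) (s≤s (s≤s ()))

  HSegment-covers : ∀ {x y} → HSegment m n u x y → ∀ k → k ≤ 1 →
                    Covered m n u (cor (k + x) y) (cor (suc k + x) y)
  HSegment-covers {x} {y} s k k≤1 =
    (x , y) , (suc (suc x) , y) ,
    (left∈A , right∈A , (λ e → n≢2+n x (cong proj₁ e)) , (suc x , y) ,
      (ℕₚ.<-trans (ℕₚ.n<1+n (suc x)) (proj₁ (proj₁ right∈A)) , proj₂ (proj₁ left∈A)) ,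
      black⇒white-right {x} {y} (proj₁ (proj₂ left∈A)) ,
      inj₂ (refl , inj₂ refl) , inj₂ (refl , inj₁ refl) , inj₂ only) ,
    on-horizontal k x y (ℕₚ.m≤n⇒m≤1+n k≤1) , on-horizontal (suc k) x y (s≤s k≤1)
    where open HSegment s

  VSegment-covers : ∀ {x y} → VSegment m n u x y → ∀ k → k ≤ 1 →
                    Covered m n u (cor x (k + y)) (cor x (suc k + y))
  VSegment-covers {x} {y} s k k≤1 =
    (x , y) , (x , suc (suc y)) ,
    (bottom∈A , top∈A , (λ e → n≢2+n y (cong proj₂ e)) , (x , suc y) ,
      (proj₁ (proj₁ bottom∈A) , ℕₚ.<-trans (ℕₚ.n<1+n (suc y)) (proj₂ (proj₁ top∈A))) ,
      black⇒white-up {x} {y} (proj₁ (proj₂ bottom∈A)) ,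
      inj₁ (refl , inj₂ refl) , inj₁ (refl , inj₁ refl) , inj₂ only) ,
    on-vertical k x y (ℕₚ.m≤n⇒m≤1+n k≤1) , on-vertical (suc k) x y (s≤s k≤1)
    where open VSegment s

record SquareFrame (m n : ℕ) (u : Point → Bool) (p q : ℕ) : Set where
  field
    bottom   : HSegment m n u p q
    top      : HSegment m n u p (suc (suc q))
    left     : VSegment m n u p q
    right    : VSegment m n u (suc (suc p)) q
    centre∉A : ¬ InA m n u (suc p , suc q)

module SquareChunk {m n : ℕ} {u : Point → Bool} {p q : ℕ} (F : SquareFrame m n u p q) where
  open SquareFrame F
  open Aᵤ {m} {n} {u}

  private
    InSq : Cell → Set
    InSq = InSq2 p q

    bottom-covered : ∀ {i} → i ≡ p ⊎ i ≡ suc p → Covered m n u (cor i q) (cor (suc i) q)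
    bottom-covered (inj₁ refl) = HSegment-covers bottom 0 z≤n
    bottom-covered (inj₂ refl) = HSegment-covers bottom 1 (s≤s z≤n)

    top-covered : ∀ {i} → i ≡ p ⊎ i ≡ suc p →
                  Covered m n u (cor i (suc (suc q))) (cor (suc i) (suc (suc q)))
    top-covered (inj₁ refl) = HSegment-covers top 0 z≤n
    top-covered (inj₂ refl) = HSegment-covers top 1 (s≤s z≤n)

    left-covered : ∀ {j} → j ≡ q ⊎ j ≡ suc q → Covered m n u (cor p j) (cor p (suc j))
    left-covered (inj₁ refl) = VSegment-covers left 0 z≤n
    left-covered (inj₂ refl) = VSegment-covers left 1 (s≤s z≤n)

    right-covered : ∀ {j} → j ≡ q ⊎ j ≡ suc q →
                    Covered m n u (cor (suc (suc p)) j) (cor (suc (suc p)) (suc j))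
    right-covered (inj₁ refl) = VSegment-covers right 0 z≤n
    right-covered (inj₂ refl) = VSegment-covers right 1 (s≤s z≤n)

    step-stays : ∀ {c c′} → SymClosure (Link m n u) c c′ → InSq c → InSq c′
    step-stays (fwd (lSE _ _)) h = h
    step-stays (fwd (lEN _ _)) h = h
    step-stays (fwd (lNW _ _)) h = h
    step-stays (fwd (lWS _ _)) h = h
    step-stays (bwd (lSE _ _)) h = h
    step-stays (bwd (lEN _ _)) h = h
    step-stays (bwd (lNW _ _)) h = h
    step-stays (bwd (lWS _ _)) h = h
    step-stays (fwd (lNS _ _ _)) (hi , inj₁ refl) = hi , inj₂ refl
    step-stays (fwd (lNS _ _ ¬cv)) (hi , inj₂ refl) = ⊥-elim (¬cv (top-covered hi))
    step-stays (bwd (lNS {i} _ _ ¬cv)) (hi , inj₁ e) =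
      ⊥-elim (¬cv (subst (λ t → Covered m n u (cor i t) (cor (suc i) t)) (sym e) (bottom-covered hi)))
    step-stays (bwd (lNS _ _ _)) (hi , inj₂ e) = hi , inj₁ (ℕₚ.suc-injective e)
    step-stays (fwd (lEW _ _ _)) (inj₁ refl , hj) = inj₂ refl , hj
    step-stays (fwd (lEW _ _ ¬cv)) (inj₂ refl , hj) = ⊥-elim (¬cv (right-covered hj))
    step-stays (bwd (lEW {j = j} _ _ ¬cv)) (inj₁ e , hj) =
      ⊥-elim (¬cv (subst (λ t → Covered m n u (cor t j) (cor t (suc j))) (sym e) (left-covered hj)))
    step-stays (bwd (lEW _ _ _)) (inj₂ e , hj) = inj₁ (ℕₚ.suc-injective e) , hj

    path-stays : ∀ {c c′} → Path {m} {n} {u} c c′ → InSq c → InSq c′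
    path-stays ε h = h
    path-stays (s ◅ ps) h = path-stays ps (step-stays s h)

    ¬A-left-mid : ¬ InA m n u (p , suc q)
    ¬A-left-mid = inA⇒¬inA-up (HSegment.left∈A bottom)
    ¬A-bottom-mid : ¬ InA m n u (suc p , q)
    ¬A-bottom-mid = inA⇒¬inA-right (HSegment.left∈A bottom)
    ¬A-top-mid : ¬ InA m n u (suc p , suc (suc q))
    ¬A-top-mid = inA⇒¬inA-right (HSegment.left∈A top)
    ¬A-right-mid : ¬ InA m n u (suc (suc p) , suc q)
    ¬A-right-mid = inA⇒¬inA-up (VSegment.bottom∈A right)

    p+2<m : suc (suc p) < m
    p+2<m = proj₁ (proj₁ (HSegment.right∈A top))
    q+2<n : suc (suc q) < n
    q+2<n = proj₂ (proj₁ (HSegment.right∈A top))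
    p+1<m : suc p < m
    p+1<m = ℕₚ.<-trans (ℕₚ.n<1+n (suc p)) p+2<m
    q+1<n : suc q < n
    q+1<n = ℕₚ.<-trans (ℕₚ.n<1+n (suc q)) q+2<n

    P = Path {m} {n} {u}

    link : ∀ {c c′} → Link m n u c c′ → P c c′
    link l = fwd l ◅ ε

    se₀₀ : P (p , q , S) (p , q , E)
    se₀₀ = link (lSE (p+1<m , q+1<n) (¬A-left-mid ∘ proj₁ ∘ covered-centre-SE p q))
    en₀₀ : P (p , q , E) (p , q , N)
    en₀₀ = link (lEN (p+1<m , q+1<n) (centre∉A ∘ proj₂ ∘ covered-centre-NE p q))
    nw₀₀ : P (p , q , N) (p , q , W)
    nw₀₀ = link (lNW (p+1<m , q+1<n) (¬A-left-mid ∘ proj₁ ∘ covered-centre-NW p q))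

    se₁₀ : P (suc p , q , S) (suc p , q , E)
    se₁₀ = link (lSE (p+2<m , q+1<n) (centre∉A ∘ proj₁ ∘ covered-centre-SE (suc p) q))
    en₁₀ : P (suc p , q , E) (suc p , q , N)
    en₁₀ = link (lEN (p+2<m , q+1<n) (¬A-bottom-mid ∘ proj₁ ∘ covered-centre-NE (suc p) q))
    nw₁₀ : P (suc p , q , N) (suc p , q , W)
    nw₁₀ = link (lNW (p+2<m , q+1<n) (centre∉A ∘ proj₁ ∘ covered-centre-NW (suc p) q))

    se₀₁ : P (p , suc q , S) (p , suc q , E)
    se₀₁ = link (lSE (p+1<m , q+2<n) (centre∉A ∘ proj₂ ∘ covered-centre-SE p (suc q)))
    en₀₁ : P (p , suc q , E) (p , suc q , N)
    en₀₁ = link (lEN (p+1<m , q+2<n) (¬A-left-mid ∘ proj₁ ∘ covered-centre-NE p (suc q)))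
    nw₀₁ : P (p , suc q , N) (p , suc q , W)
    nw₀₁ = link (lNW (p+1<m , q+2<n) (centre∉A ∘ proj₂ ∘ covered-centre-NW p (suc q)))

    se₁₁ : P (suc p , suc q , S) (suc p , suc q , E)
    se₁₁ = link (lSE (p+2<m , q+2<n) (¬A-top-mid ∘ proj₁ ∘ covered-centre-SE (suc p) (suc q)))
    en₁₁ : P (suc p , suc q , E) (suc p , suc q , N)
    en₁₁ = link (lEN (p+2<m , q+2<n) (centre∉A ∘ proj₁ ∘ covered-centre-NE (suc p) (suc q)))
    nw₁₁ : P (suc p , suc q , N) (suc p , suc q , W)
    nw₁₁ = link (lNW (p+2<m , q+2<n) (¬A-top-mid ∘ proj₁ ∘ covered-centre-NW (suc p) (suc q)))

    ew₀ : P (p , q , E) (suc p , q , W)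
    ew₀ = link (lEW (p+1<m , q+1<n) (p+2<m , q+1<n) ¬cv)
      where
      ¬cv : ¬ Covered m n u (cor (suc p) q) (cor (suc p) (suc q))
      ¬cv cv with covered-vedge (suc p) q cv
      ... | first-half s = ¬A-bottom-mid (VSegment.bottom∈A s)
      ... | second-half s = centre∉A (VSegment.top∈A s)

    ns₀ : P (p , q , N) (p , suc q , S)
    ns₀ = link (lNS (p+1<m , q+1<n) (p+1<m , q+2<n) ¬cv)
      where
      ¬cv : ¬ Covered m n u (cor p (suc q)) (cor (suc p) (suc q))
      ¬cv cv with covered-hedge p (suc q) cv
      ... | first-half s = ¬A-left-mid (HSegment.left∈A s)
      ... | second-half s = centre∉A (HSegment.right∈A s)

    ns₁ : P (suc p , q , N) (suc p , suc q , S)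
    ns₁ = link (lNS (p+2<m , q+1<n) (p+2<m , q+2<n) ¬cv)
      where
      ¬cv : ¬ Covered m n u (cor (suc p) (suc q)) (cor (suc (suc p)) (suc q))
      ¬cv cv with covered-hedge (suc p) (suc q) cv
      ... | first-half s = centre∉A (HSegment.left∈A s)
      ... | second-half s = ¬A-right-mid (HSegment.right∈A s)

    to₁₀W : P (p , q , S) (suc p , q , W)
    to₁₀W = se₀₀ ◅◅ ew₀
    to₁₀N : P (p , q , S) (suc p , q , N)
    to₁₀N = to₁₀W ◅◅ path-reverse nw₁₀
    to₁₀E : P (p , q , S) (suc p , q , E)
    to₁₀E = to₁₀N ◅◅ path-reverse en₁₀
    to₀₁S : P (p , q , S) (p , suc q , S)
    to₀₁S = se₀₀ ◅◅ en₀₀ ◅◅ ns₀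
    to₁₁S : P (p , q , S) (suc p , suc q , S)
    to₁₁S = to₁₀N ◅◅ ns₁

    from-corner : ∀ c → InSq c → P (p , q , S) c
    from-corner (_ , _ , S) (inj₁ refl , inj₁ refl) = ε
    from-corner (_ , _ , E) (inj₁ refl , inj₁ refl) = se₀₀
    from-corner (_ , _ , N) (inj₁ refl , inj₁ refl) = se₀₀ ◅◅ en₀₀
    from-corner (_ , _ , W) (inj₁ refl , inj₁ refl) = se₀₀ ◅◅ en₀₀ ◅◅ nw₀₀
    from-corner (_ , _ , S) (inj₂ refl , inj₁ refl) = to₁₀E ◅◅ path-reverse se₁₀
    from-corner (_ , _ , E) (inj₂ refl , inj₁ refl) = to₁₀E
    from-corner (_ , _ , N) (inj₂ refl , inj₁ refl) = to₁₀N
    from-corner (_ , _ , W) (inj₂ refl , inj₁ refl) = to₁₀W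
    from-corner (_ , _ , S) (inj₁ refl , inj₂ refl) = to₀₁S
    from-corner (_ , _ , E) (inj₁ refl , inj₂ refl) = to₀₁S ◅◅ se₀₁
    from-corner (_ , _ , N) (inj₁ refl , inj₂ refl) = to₀₁S ◅◅ se₀₁ ◅◅ en₀₁
    from-corner (_ , _ , W) (inj₁ refl , inj₂ refl) = to₀₁S ◅◅ se₀₁ ◅◅ en₀₁ ◅◅ nw₀₁
    from-corner (_ , _ , S) (inj₂ refl , inj₂ refl) = to₁₁S
    from-corner (_ , _ , E) (inj₂ refl , inj₂ refl) = to₁₁S ◅◅ se₁₁
    from-corner (_ , _ , N) (inj₂ refl , inj₂ refl) = to₁₁S ◅◅ se₁₁ ◅◅ en₁₁
    from-corner (_ , _ , W) (inj₂ refl , inj₂ refl) = to₁₁S ◅◅ se₁₁ ◅◅ en₁₁ ◅◅ nw₁₁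

  -- Links cannot cross the framing segments, and the centre is not in A_u, so inside links connect
  -- all sixteen triangles.
  isSquare2 : ∀ {c₀ c} → Chunk m n u c₀ c → InSq2 p q c → IsSquare2 (Chunk m n u c₀)
  isSquare2 {c₀} {c} c₀~c c∈sq = p , q , λ c′ →
    (λ c₀~c′ → path-stays (path-reverse c₀~c ◅◅ c₀~c′) c∈sq) ,
    (λ c′∈sq → c₀~c ◅◅ (path-reverse (from-corner c c∈sq) ◅◅ from-corner c′ c′∈sq))

-- Transposition

transpose : (Point → Bool) → (Point → Bool)
transpose u = u ∘ swap

flipTri : Tri → Tri
flipTri S = W
flipTri E = N
flipTri N = E
flipTri W = S

flipCell : Cell → Cell
flipCell (i , j , t) = j , i , flipTri t

flipCell-involutive : ∀ c → flipCell (flipCell c) ≡ c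
flipCell-involutive (i , j , S) = refl
flipCell-involutive (i , j , E) = refl
flipCell-involutive (i , j , N) = refl
flipCell-involutive (i , j , W) = refl

private

  black-transpose : ∀ {b} → Black b → Black (swap b)
  black-transpose {x , y} = even-cong (ℕₚ.+-comm x y)

  white-transpose : ∀ {b} → White b → White (swap b)
  white-transpose {x , y} = subst (λ k → k % 2 ≡ 1) (ℕₚ.+-comm x y)

  InA-transpose : ∀ {m n u b} → InA m n u b → InA n m (transpose u) (swap b)
  InA-transpose {b = b} (b∈G , black , ub) = swap b∈G , black-transpose {b} black , ub

  Nbr-transpose : ∀ {w b} → Nbr w b → Nbr (swap w) (swap b)
  Nbr-transpose = Data.Sum.swap

  dot-transpose : ∀ P Q → dot (swap P) (swap Q) ≡ dot P Q
  dot-transpose (a , b) (c , d) = ℤₚ.+-comm (b *ᶻ d) (a *ᶻ c)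

  cross-transpose : ∀ P Q → cross (swap P) (swap Q) ≡ -ᶻ cross P Q
  cross-transpose (a , b) (c , d) = anticommute a b c d
    where
    anticommute : ∀ a b c d → b *ᶻ c -ᶻ a *ᶻ d ≡ -ᶻ (a *ᶻ d -ᶻ b *ᶻ c)
    anticommute = solve-∀

  OnSeg-transpose : ∀ {P B₁ B₂} → OnSeg P B₁ B₂ → OnSeg (swap P) (swap B₁) (swap B₂)
  OnSeg-transpose {P} {B₁} {B₂} (c , lo , hi) =
    trans (cross-transpose Q D) (cong -ᶻ_ c) ,
    subst (+ 0 ≤ᶻ_) (sym (dot-transpose Q D)) lo ,
    subst₂ _≤ᶻ_ (sym (dot-transpose Q D)) (sym (dot-transpose D D)) hi
    where
    Q = sub P B₁
    D = sub B₂ B₁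

  AdjA-transpose : ∀ {m n u b₁ b₂} → AdjA m n u b₁ b₂ → AdjA n m (transpose u) (swap b₁) (swap b₂)
  AdjA-transpose {m} {n} {u} {b₁} {b₂} (b₁∈A , b₂∈A , b₁≢b₂ , w , w∈G , white , w~b₁ , w~b₂ , po) =
    InA-transpose {m} {n} {u} b₁∈A , InA-transpose {m} {n} {u} b₂∈A , b₁≢b₂ ∘ cong swap , swap w , swap w∈G ,
    white-transpose {w} white , Nbr-transpose w~b₁ , Nbr-transpose w~b₂ ,
    Data.Sum.map (trans (dot-transpose (sub (toℤ² b₁) (toℤ² w)) (sub (toℤ² b₂) (toℤ² w)))) only po
    where
    only : OnlyNbrs m n u w b₁ b₂ → OnlyNbrs n m (transpose u) (swap w) (swap b₁) (swap b₂)
    only o b b∈A w~b = Data.Sum.map (cong swap) (cong swap)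
      (o (swap b) (InA-transpose {m = n} {n = m} {u = transpose u} b∈A) (Nbr-transpose w~b))

  Covered-transpose : ∀ {m n u P Q} → Covered m n u P Q → Covered n m (transpose u) (swap P) (swap Q)
  Covered-transpose {P = P} {Q} (b₁ , b₂ , adj , P∈ , Q∈) =
    swap b₁ , swap b₂ , AdjA-transpose adj ,
    OnSeg-transpose {toℤ² P} {dbl b₁} {dbl b₂} P∈ , OnSeg-transpose {toℤ² Q} {dbl b₁} {dbl b₂} Q∈

  Link-transpose : ∀ {m n u c c′} → Link m n u c c′ →
                   SymClosure (Link n m (transpose u)) (flipCell c) (flipCell c′)
  Link-transpose (lSE v ¬cv) = bwd (lNW (swap v) (¬cv ∘ Covered-transpose))
  Link-transpose (lEN v ¬cv) = bwd (lEN (swap v) (¬cv ∘ Covered-transpose))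
  Link-transpose (lNW v ¬cv) = bwd (lSE (swap v) (¬cv ∘ Covered-transpose))
  Link-transpose (lWS v ¬cv) = bwd (lWS (swap v) (¬cv ∘ Covered-transpose))
  Link-transpose (lNS v v′ ¬cv) = fwd (lEW (swap v) (swap v′) (¬cv ∘ Covered-transpose))
  Link-transpose (lEW v v′ ¬cv) = fwd (lNS (swap v) (swap v′) (¬cv ∘ Covered-transpose))

  Chunk-transpose : ∀ {m n u c₀ c} → Chunk m n u c₀ c → Chunk n m (transpose u) (flipCell c₀) (flipCell c)
  Chunk-transpose {m} {n} {u} = gmap flipCell step
    where
    step : ∀ {c c′} → SymClosure (Link m n u) c c′ →
           SymClosure (Link n m (transpose u)) (flipCell c) (flipCell c′)
    step (fwd l) = Link-transpose l
    step (bwd l) = symmetric _ (Link-transpose l)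

  Chunk-untranspose : ∀ {m n u c₀ c} → Chunk n m (transpose u) (flipCell c₀) c → Chunk m n u c₀ (flipCell c)
  Chunk-untranspose {m} {n} {u} {c₀} p =
    subst (λ c → Chunk m n u c _) (flipCell-involutive c₀) (Chunk-transpose {n} {m} {transpose u} p)

  parity-↭ : ∀ {xs ys} → xs ↭ ys → parity xs ≡ parity ys
  parity-↭ ↭.refl = refl
  parity-↭ (↭.prep x p) = cong (x xor_) (parity-↭ p)
  parity-↭ (↭.swap {xs} {ys} x y p) = begin
    x xor (y xor parity xs)   ≡⟨ 𝔹.xor-assoc x y _ ⟨
    (x xor y) xor parity xs   ≡⟨ cong₂ _xor_ (𝔹.xor-comm x y) (parity-↭ p) ⟩
    (y xor x) xor parity ys   ≡⟨ 𝔹.xor-assoc y x _ ⟩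
    y xor (x xor parity ys)   ∎
    where open ≡-Reasoning
  parity-↭ (↭.trans p q) = trans (parity-↭ p) (parity-↭ q)

  latticeNbrs-transpose : ∀ w → map swap (latticeNbrs w) ↭ latticeNbrs (swap w)
  latticeNbrs-transpose (zero , zero) = ↭.swap _ _ ↭.refl
  latticeNbrs-transpose (zero , suc y) = ↭.swap _ _ ↭.refl
  latticeNbrs-transpose (suc x , zero) = ↭.swap _ _ ↭.refl
  latticeNbrs-transpose (suc x , suc y) = ↭.swap _ _ (↭.swap _ _ ↭.refl)

  parity≡false⇒BW≡0 : ∀ {m n u} w → parity (map (χ m n u) (latticeNbrs w)) ≡ false → BW m n u w ≡ 0
  parity≡false⇒BW≡0 {m} {n} {u} w p =
    trans (length-filterᵇ-parity (χ m n u) (latticeNbrs w)) (cong (if_then 1 else 0) p)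

  InKerBW-transpose : ∀ {m n u} → InKerBW m n u → InKerBW n m (transpose u)
  InKerBW-transpose {m} {n} {u} K w w∈G white = parity≡false⇒BW≡0 {n} {m} {transpose u} w (begin
    parity (map (χ n m (transpose u)) L)  ≡⟨ cong parity (map-cong χ-transpose L) ⟩
    parity (map (χ m n u ∘ swap) L)       ≡⟨ cong parity (map-∘ {g = χ m n u} {f = swap} L) ⟩
    parity (map (χ m n u) (map swap L))   ≡⟨ parity-↭ (map⁺ (χ m n u) (latticeNbrs-transpose w)) ⟩
    parity (map (χ m n u) (latticeNbrs (swap w)))
      ≡⟨ Aᵤ.kernel-parity {m} {n} {u} K (swap w∈G) (white-transpose {w} white) ⟩
    false                                 ∎)
    where
    open ≡-Reasoning
    L = latticeNbrs w
    χ-transpose : ∀ b → χ n m (transpose u) b ≡ χ m n u (swap b)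
    χ-transpose (x , y) = cong (_∧ u (y , x)) (𝔹.∧-comm (x <ᵇ n) (y <ᵇ m))

  ExactlyCount-↭ : ∀ {P xs ys k} → xs ↭ ys → ExactlyCount P xs k → ExactlyCount P ys k
  ExactlyCount-↭ ↭.refl ec = ec
  ExactlyCount-↭ (↭.prep _ p) (ecYes px ec) = ecYes px (ExactlyCount-↭ p ec)
  ExactlyCount-↭ (↭.prep _ p) (ecNo ¬px ec) = ecNo ¬px (ExactlyCount-↭ p ec)
  ExactlyCount-↭ (↭.swap _ _ p) (ecYes px (ecYes py ec)) = ecYes py (ecYes px (ExactlyCount-↭ p ec))
  ExactlyCount-↭ (↭.swap _ _ p) (ecYes px (ecNo ¬py ec)) = ecNo ¬py (ecYes px (ExactlyCount-↭ p ec))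
  ExactlyCount-↭ (↭.swap _ _ p) (ecNo ¬px (ecYes py ec)) = ecYes py (ecNo ¬px (ExactlyCount-↭ p ec))
  ExactlyCount-↭ (↭.swap _ _ p) (ecNo ¬px (ecNo ¬py ec)) = ecNo ¬py (ecNo ¬px (ExactlyCount-↭ p ec))
  ExactlyCount-↭ (↭.trans p q) ec = ExactlyCount-↭ q (ExactlyCount-↭ p ec)

  ExactlyCount-map : ∀ {P Q : Cell → Set} {f k} xs → (∀ c → P (f c) → Q c) → (∀ c → Q c → P (f c)) →
                     ExactlyCount P (map f xs) k → ExactlyCount Q xs k
  ExactlyCount-map [] to from ec[] = ec[]
  ExactlyCount-map (x ∷ xs) to from (ecYes p ec) = ecYes (to x p) (ExactlyCount-map xs to from ec)
  ExactlyCount-map (x ∷ xs) to from (ecNo ¬p ec) = ecNo (¬p ∘ from x) (ExactlyCount-map xs to from ec)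

  -- Transposition reverses the two triangles of each square at a corner and swaps the squares
  -- below-right and above-left of it.
  cornerCells-transpose : ∀ x y → map flipCell (cornerCells y x) ↭ cornerCells x y
  cornerCells-transpose zero zero = ↭.swap _ _ ↭.refl
  cornerCells-transpose zero (suc y) = ↭.swap _ _ (↭.swap _ _ ↭.refl)
  cornerCells-transpose (suc x) zero = ↭.swap _ _ (↭.swap _ _ ↭.refl)
  cornerCells-transpose (suc x) (suc y) = ↭.swap _ _
    (↭.trans (shifts (_ ∷ _ ∷ []) (_ ∷ _ ∷ [])) (↭.swap _ _ (↭.swap _ _ (↭.swap _ _ ↭.refl))))

  RightAngleAt-transpose : ∀ {P Q : Cell → Set} {x y} →
                           (∀ c → P (flipCell c) → Q c) → (∀ c → Q c → P (flipCell c)) →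
                           RightAngleAt P x y → RightAngleAt Q y x
  RightAngleAt-transpose {x = x} {y} to from ra =
    ExactlyCount-map (cornerCells y x) to from (ExactlyCount-↭ (↭-sym (cornerCells-transpose x y)) ra)

  IsSquare2-untranspose : ∀ {m n u c₀} →
                          IsSquare2 (Chunk n m (transpose u) (flipCell c₀)) → IsSquare2 (Chunk m n u c₀)
  IsSquare2-untranspose {m} {n} {u} {c₀} (a , b , sq) = b , a , λ c →
    (λ c₀~c → swap (proj₁ (sq (flipCell c)) (Chunk-transpose c₀~c))) ,
    (λ c∈ → subst (Chunk m n u c₀) (flipCell-involutive c)
              (Chunk-untranspose (proj₂ (sq (flipCell c)) (swap c∈))))

  beside-transpose : ∀ {m n u c₀ i y} → BdV (Chunk m n u c₀) i y →
                     aboveH (Chunk n m (transpose u) (flipCell c₀)) y i ⊎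
                     belowH (Chunk n m (transpose u) (flipCell c₀)) y i
  beside-transpose (inj₂ (_ , right)) = inj₁ (Chunk-transpose right)
  beside-transpose {i = suc i} (inj₁ (left , _)) = inj₂ (Chunk-transpose left)

-- The kernel condition at a white point determines its fourth neighbour from the other three.

module Completion {m n : ℕ} {u : Point → Bool} (K : InKerBW m n u) where
  open Aᵤ {m} {n} {u}

  VSegment-from-bottom : ∀ {x y} → suc y < n → InA m n u (x , y) → ¬ InA m n u (suc x , suc y) →
                (∀ x′ → suc x′ ≡ x → ¬ InA m n u (x′ , suc y)) → VSegment m n u x y
  VSegment-from-bottom {x} {y} y+1<n bottom ¬right ¬left = record
    { bottom∈A = bottom
    ; top∈A    = χ≡true⇒inA (black⇒black-up² {x} {y} black) (solve (χ m n u (x , suc (suc y)))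
                   (¬inA⇒χ≡false (black⇒black-diag {x} {y} black) ¬right) (χ←≡false white ¬left)
                   (inA⇒χ≡true bottom) (kernel-at K (proj₁ (proj₁ bottom) , y+1<n) white))
    ; only     = onlyNbrs-by-direction (λ _ → inj₂ refl) (λ { _ refl _ → inj₁ refl })
                   (⊥-elim ∘ ¬right) (λ x′ e → ⊥-elim ∘ ¬left x′ e)
    }
    where
    black = proj₁ (proj₂ bottom)
    white = black⇒white-up {x} {y} black
    solve : ∀ t {r l d} → r ≡ false → l ≡ false → d ≡ true → r xor (t xor (l xor d)) ≡ false → t ≡ true
    solve true  refl refl refl _ = refl
    solve false refl refl refl ()

  VSegment-from-top : ∀ {x y} → InA m n u (x , suc (suc y)) → ¬ InA m n u (suc x , suc y) →
                  (∀ x′ → suc x′ ≡ x → ¬ InA m n u (x′ , suc y)) → VSegment m n u x y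
  VSegment-from-top {x} {y} top ¬right ¬left = record
    { bottom∈A = χ≡true⇒inA (black-up²⇒black {x} {y} black) (solve (χ m n u (x , y))
                   (¬inA⇒χ≡false (black-up⇒black-right {x} {suc y} black) ¬right) (inA⇒χ≡true top)
                   (χ←≡false white ¬left) (kernel-at K w∈G white))
    ; top∈A    = top
    ; only     = onlyNbrs-by-direction (λ _ → inj₂ refl) (λ { _ refl _ → inj₁ refl })
                   (⊥-elim ∘ ¬right) (λ x′ e → ⊥-elim ∘ ¬left x′ e)
    }
    where
    black = proj₁ (proj₂ top)
    white = black-up⇒white {x} {suc y} black
    w∈G : InG m n (x , suc y)
    w∈G = proj₁ (proj₁ top) , ℕₚ.<-trans (ℕₚ.n<1+n (suc y)) (proj₂ (proj₁ top))
    solve : ∀ t {r p l} → r ≡ false → p ≡ true → l ≡ false → r xor (p xor (l xor t)) ≡ false → t ≡ true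
    solve true  refl refl refl _ = refl
    solve false refl refl refl ()

  HSegment-closing-top : ∀ {x y} → InA m n u (x , suc y) → InA m n u (suc (suc x) , suc y) →
                        ¬ InA m n u (suc x , y) → HSegment m n u x (suc y)
  HSegment-closing-top {x} {y} left right ¬below = record
    { left∈A  = left
    ; right∈A = right
    ; only    = onlyNbrs-by-direction (⊥-elim ∘ χ≡false⇒¬inA above) (λ { _ refl → ⊥-elim ∘ ¬below })
                  (λ _ → inj₂ refl) (λ { _ refl _ → inj₁ refl })
    }
    where
    black = proj₁ (proj₂ left)
    white = black⇒white-right {x} {suc y} black
    w∈G : InG m n (suc x , suc y)
    w∈G = ℕₚ.<-trans (ℕₚ.n<1+n (suc x)) (proj₁ (proj₁ right)) , proj₂ (proj₁ left)
    solve : ∀ t {r l d} → r ≡ true → l ≡ true → d ≡ false → r xor (t xor (l xor d)) ≡ false → t ≡ false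
    solve false refl refl refl _ = refl
    solve true  refl refl refl ()
    above : χ m n u (suc x , suc (suc y)) ≡ false
    above = solve _ (inA⇒χ≡true right) (inA⇒χ≡true left)
                  (¬inA⇒χ≡false (black-up⇒black-right {x} {y} black) ¬below) (kernel-at K w∈G white)

  HSegment-closing-bottom : ∀ {x y} → InA m n u (x , y) → InA m n u (suc (suc x) , y) →
                          ¬ InA m n u (suc x , suc y) → HSegment m n u x y
  HSegment-closing-bottom {x} {y} left right ¬above = record
    { left∈A  = left
    ; right∈A = right
    ; only    = onlyNbrs-by-direction (⊥-elim ∘ ¬above) (λ y′ e → ⊥-elim ∘ χ↓≡false⇒¬inA below y′ e)
                  (λ _ → inj₂ refl) (λ { _ refl _ → inj₁ refl })
    }
    where
    black = proj₁ (proj₂ left)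
    white = black⇒white-right {x} {y} black
    w∈G : InG m n (suc x , y)
    w∈G = ℕₚ.<-trans (ℕₚ.n<1+n (suc x)) (proj₁ (proj₁ right)) , proj₂ (proj₁ left)
    solve : ∀ t {r p l} → r ≡ true → p ≡ false → l ≡ true → r xor (p xor (l xor t)) ≡ false → t ≡ false
    solve false refl refl refl _ = refl
    solve true  refl refl refl ()
    below : χ↓ (suc x , y) ≡ false
    below = solve _ (inA⇒χ≡true right) (¬inA⇒χ≡false (black⇒black-diag {x} {y} black) ¬above)
                  (inA⇒χ≡true left) (kernel-at K w∈G white)

-- Chunks with an active horizontal side

module ActiveSide {m n : ℕ} {u : Point → Bool} (K : InKerBW m n u) {c₀ : Cell} (v₀ : ValidCell m n c₀) where
  open Aᵤ {m} {n} {u}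
  open Completion K

  private
    A : Point → Set
    A = InA m n u

    C : Cell → Set
    C = Chunk m n u c₀

    valid : ∀ {c} → C c → ValidCell m n c
    valid = path-valid v₀

    <-pred : ∀ {a k} → suc a < k → a < k
    <-pred = ℕₚ.<-trans (ℕₚ.n<1+n _)

    successor-cases : ∀ {a b} → a < b → b ≡ suc a ⊎ b ≡ suc (suc a) ⊎ suc (suc a) < b
    successor-cases a<b with ℕₚ.m≤n⇒m<n∨m≡n a<b
    ... | inj₂ e = inj₁ (sym e)
    ... | inj₁ a+1<b with ℕₚ.m≤n⇒m<n∨m≡n a+1<b
    ...   | inj₂ e = inj₂ (inj₁ (sym e))
    ...   | inj₁ a+2<b = inj₂ (inj₂ a+2<b)

  midpoint-¬rightAngle-above : ∀ {a j} → C (suc a , j , S) → HSegment m n u a j → ¬ RightAngleAt C (suc a) j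
  midpoint-¬rightAngle-above {a} {j} S₀ s = three-cells⇒¬rightAngle (refl ∷ refl ∷ refl ∷ minimum _) S₀ W₀ S′
    where
    vS₀ = valid S₀
    ¬A-mid : ¬ A (suc a , j)
    ¬A-mid = inA⇒¬inA-right (HSegment.left∈A s)
    W₀ : C (suc a , j , W)
    W₀ = chunk-bwd S₀ (lWS vS₀ (¬A-mid ∘ proj₁ ∘ covered-centre-SW (suc a) j))
    vE′ : ValidCell m n (a , j , E)
    vE′ = <-pred (proj₁ vS₀) , proj₂ vS₀
    E′ : C (a , j , E)
    E′ = chunk-bwd W₀ (lEW vE′ vS₀ (midpoint-vedge-above-uncovered s))
    S′ : C (a , j , S)
    S′ = chunk-bwd E′ (lSE vE′ (¬A-mid ∘ proj₂ ∘ covered-centre-SE a j))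

  left-side-above : ∀ {a j} → C (a , j , S) → C (a , j , W) → RightAngleAt C a j →
                    A (a , j) → ¬ A (suc a , suc j) → VSegment m n u a j
  left-side-above {zero} S₀ _ _ BL∈A centre∉A = VSegment-from-bottom (proj₂ (valid S₀)) BL∈A centre∉A (λ _ ())
  left-side-above {suc a} {j} S₀ W₀ ra BL∈A _ =
    VSegment-stable (λ ¬s → ¬¬covered (¬s ∘ covered-vedge-from-A BL∈A))
    where
    -- An uncovered edge would let the triangle left of it join C as a third triangle at the corner.
    ¬¬covered : ¬ ¬ Covered m n u (cor (suc a) j) (cor (suc a) (suc j))
    ¬¬covered ¬cv = three-cells⇒¬rightAngle (refl ∷ refl ∷ _ ∷ʳ refl ∷ minimum _) S₀ W₀
      (chunk-bwd W₀ (lEW (<-pred (proj₁ (valid W₀)) , proj₂ (valid W₀)) (valid W₀) ¬cv)) ra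

  module Above {a j : ℕ} (S₀ : C (a , j , S)) (ra : RightAngleAt C a j) (bottom : HSegment m n u a j) where
    private
      BL∈A = HSegment.left∈A bottom
      BR∈A = HSegment.right∈A bottom
      vS₀ = valid S₀
      vS₁ : ValidCell m n (suc a , j , S)
      vS₁ = proj₁ (proj₁ BR∈A) , proj₂ vS₀

      centre∉A : ¬ A (suc a , suc j)
      centre∉A = above-midpoint∉A bottom

      W₀ : C (a , j , W)
      W₀ = chunk-bwd S₀ (lWS vS₀ (centre∉A ∘ proj₂ ∘ covered-centre-SW a j))
      E₀ : C (a , j , E)
      E₀ = chunk-fwd S₀ (lSE vS₀ (inA⇒¬inA-up BL∈A ∘ proj₁ ∘ covered-centre-SE a j))
      W₁ : C (suc a , j , W)
      W₁ = chunk-fwd E₀ (lEW vS₀ vS₁ (midpoint-vedge-above-uncovered bottom))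
      S₁ : C (suc a , j , S)
      S₁ = chunk-fwd W₁ (lWS vS₁ (inA⇒¬inA-right BL∈A ∘ proj₁ ∘ covered-centre-SW (suc a) j))
      E₁ : C (suc a , j , E)
      E₁ = chunk-fwd S₁ (lSE vS₁ (centre∉A ∘ proj₁ ∘ covered-centre-SE (suc a) j))

      left : VSegment m n u a j
      left = left-side-above S₀ W₀ ra BL∈A centre∉A

      right : ∀ {b} → a < b → ActiveH m n u j a b → RightAngleAt C b j → VSegment m n u (suc (suc a)) j
      right a<b act rb with successor-cases a<b
      ... | inj₁ refl = ⊥-elim (three-cells⇒¬rightAngle (refl ∷ refl ∷ refl ∷ minimum _) S₁ W₁ S₀ rb)
      ... | inj₂ (inj₁ refl) with suc (suc (suc a)) <? m
      ...   | yes a+3<m = VSegment-stable (λ ¬s →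
                ¬W₂ (chunk-fwd E₁ (lEW vS₁ (a+3<m , proj₂ vS₀) (¬s ∘ covered-vedge-from-A BR∈A))))
        where
        ¬W₂ : ¬ C (suc (suc a) , j , W)
        ¬W₂ W₂ = three-cells⇒¬rightAngle (_ ∷ʳ refl ∷ refl ∷ refl ∷ minimum _) W₂ S₁ E₁ rb
      ...   | no a+3≮m =
        VSegment-from-bottom (proj₂ vS₀) BR∈A (λ a → a+3≮m (proj₁ (proj₁ a))) (λ { _ refl → centre∉A })
      right a<b act rb | inj₂ (inj₂ a+2<b) =
        VSegment-from-bottom (proj₂ vS₀) BR∈A ¬right (λ { _ refl → centre∉A })
        where
        ¬right : ¬ A (suc (suc (suc a)) , suc j)
        ¬right = above-midpoint∉A (covered-hedge-from-A BR∈A (act (suc (suc a)) (ℕₚ.m≤n+m a 2) a+2<b))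

    isSquare2 : ∀ {b} → a < b → ActiveH m n u j a b → RightAngleAt C b j → IsSquare2 C
    isSquare2 a<b act rb = SquareChunk.isSquare2 frame S₀ (inj₁ refl , inj₁ refl)
      where
      frame : SquareFrame m n u a j
      frame = record
        { bottom = bottom
        ; top = HSegment-closing-top (VSegment.top∈A left) (VSegment.top∈A (right a<b act rb)) centre∉A
        ; left = left
        ; right = right a<b act rb
        ; centre∉A = centre∉A
        }

  chunk-above : ∀ {a j b} → C (a , j , S) → a < b → ActiveH m n u j a b →
                RightAngleAt C a j → RightAngleAt C b j → IsSquare2 C
  chunk-above {a} {j} S₀ a<b act ra rb with covered-hedge a j (act a ℕₚ.≤-refl a<b)
  ... | first-half s = Above.isSquare2 S₀ ra s a<b act rb
  ... | second-half s = ⊥-elim (midpoint-¬rightAngle-above S₀ s ra)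

  midpoint-¬rightAngle-below : ∀ {a j} → C (suc a , j , N) → HSegment m n u a (suc j) →
                             ¬ RightAngleAt C (suc a) (suc j)
  midpoint-¬rightAngle-below {a} {j} N₀ s =
    three-cells⇒¬rightAngle (_ ∷ʳ _ ∷ʳ _ ∷ʳ _ ∷ʳ refl ∷ refl ∷ refl ∷ minimum _) N₀ W₀ E′
    where
    vN₀ = valid N₀
    W₀ : C (suc a , j , W)
    W₀ = chunk-fwd N₀ (lNW vN₀ (inA⇒¬inA-right (HSegment.left∈A s) ∘ proj₁ ∘ covered-centre-NW (suc a) j))
    E′ : C (a , j , E)
    E′ = chunk-bwd W₀ (lEW (<-pred (proj₁ vN₀) , proj₂ vN₀) vN₀ (midpoint-vedge-below-uncovered s))

  left-edge-below-covered : ∀ {a j} → C (suc a , j , N) → C (suc a , j , W) → RightAngleAt C (suc a) (suc j) →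
                            ¬ ¬ Covered m n u (cor (suc a) j) (cor (suc a) (suc j))
  left-edge-below-covered N₀ W₀ ra ¬cv = three-cells⇒¬rightAngle
    (_ ∷ʳ _ ∷ʳ _ ∷ʳ _ ∷ʳ refl ∷ refl ∷ refl ∷ minimum _) N₀ W₀
    (chunk-bwd W₀ (lEW (<-pred (proj₁ (valid W₀)) , proj₂ (valid W₀)) (valid W₀) ¬cv)) ra

  left-side-below : ∀ {a q} → C (a , suc q , N) → C (a , suc q , W) → RightAngleAt C a (suc (suc q)) →
                    A (a , suc (suc q)) → ¬ A (suc a , suc q) → VSegment m n u a q
  left-side-below {zero} _ _ _ TL∈A centre∉A = VSegment-from-top TL∈A centre∉A (λ _ ())
  left-side-below {suc a} N₀ W₀ ra TL∈A _ =
    VSegment-stable (λ ¬s → left-edge-below-covered N₀ W₀ ra (¬s ∘ covered-vedge-to-A TL∈A))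

  module Below {a q : ℕ} (N₀ : C (a , suc q , N)) (ra : RightAngleAt C a (suc (suc q)))
               (top : HSegment m n u a (suc (suc q))) where
    private
      TL∈A = HSegment.left∈A top
      TR∈A = HSegment.right∈A top
      vN₀ = valid N₀
      vN₁ : ValidCell m n (suc a , suc q , N)
      vN₁ = proj₁ (proj₁ TR∈A) , proj₂ vN₀

      centre∉A : ¬ A (suc a , suc q)
      centre∉A = below-midpoint∉A top

      W₀ : C (a , suc q , W)
      W₀ = chunk-fwd N₀ (lNW vN₀ (centre∉A ∘ proj₂ ∘ covered-centre-NW a (suc q)))
      E₀ : C (a , suc q , E)
      E₀ = chunk-bwd N₀ (lEN vN₀ ((λ a → inA⇒¬inA-up a TL∈A) ∘ proj₁ ∘ covered-centre-NE a (suc q)))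
      W₁ : C (suc a , suc q , W)
      W₁ = chunk-fwd E₀ (lEW vN₀ vN₁ (midpoint-vedge-below-uncovered top))
      N₁ : C (suc a , suc q , N)
      N₁ = chunk-bwd W₁ (lNW vN₁ (inA⇒¬inA-right TL∈A ∘ proj₁ ∘ covered-centre-NW (suc a) (suc q)))
      E₁ : C (suc a , suc q , E)
      E₁ = chunk-bwd N₁ (lEN vN₁ (centre∉A ∘ proj₁ ∘ covered-centre-NE (suc a) (suc q)))

      left : VSegment m n u a q
      left = left-side-below N₀ W₀ ra TL∈A centre∉A

      right : ∀ {b} → a < b → ActiveH m n u (suc (suc q)) a b → RightAngleAt C b (suc (suc q)) →
              VSegment m n u (suc (suc a)) q
      right a<b act rb with successor-cases a<b
      ... | inj₁ refl = ⊥-elim (three-cells⇒¬rightAngle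
              (_ ∷ʳ _ ∷ʳ _ ∷ʳ _ ∷ʳ refl ∷ refl ∷ refl ∷ minimum _) N₁ W₁ E₀ rb)
      ... | inj₂ (inj₁ refl) with suc (suc (suc a)) <? m
      ...   | yes a+3<m = VSegment-stable (λ ¬s →
                ¬W₂ (chunk-fwd E₁ (lEW vN₁ (a+3<m , proj₂ vN₀) (¬s ∘ covered-vedge-to-A TR∈A))))
        where
        ¬W₂ : ¬ C (suc (suc a) , suc q , W)
        ¬W₂ W₂ = three-cells⇒¬rightAngle (_ ∷ʳ _ ∷ʳ _ ∷ʳ _ ∷ʳ _ ∷ʳ refl ∷ refl ∷ refl ∷ []) W₂ E₁ N₁ rb
      ...   | no a+3≮m = VSegment-from-top TR∈A (λ a → a+3≮m (proj₁ (proj₁ a))) (λ { _ refl → centre∉A })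
      right a<b act rb | inj₂ (inj₂ a+2<b) = VSegment-from-top TR∈A ¬right (λ { _ refl → centre∉A })
        where
        ¬right : ¬ A (suc (suc (suc a)) , suc q)
        ¬right = below-midpoint∉A (covered-hedge-from-A TR∈A (act (suc (suc a)) (ℕₚ.m≤n+m a 2) a+2<b))

    isSquare2 : ∀ {b} → a < b → ActiveH m n u (suc (suc q)) a b → RightAngleAt C b (suc (suc q)) → IsSquare2 C
    isSquare2 a<b act rb = SquareChunk.isSquare2 frame N₀ (inj₁ refl , inj₂ refl)
      where
      frame : SquareFrame m n u a q
      frame = record
        { bottom = HSegment-closing-bottom (VSegment.bottom∈A left) (VSegment.bottom∈A (right a<b act rb))
                                           centre∉A
        ; top = top
        ; left = left
        ; right = right a<b act rb
        ; centre∉A = centre∉A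
        }

  -- A square below a side at height 1 would leave the grid.
  first-row-¬rightAngle : ∀ {a} → C (a , 0 , N) → HSegment m n u a 1 → ¬ RightAngleAt C a 1
  first-row-¬rightAngle {zero} _ s _ with proj₁ (proj₂ (HSegment.left∈A s))
  ... | ()
  first-row-¬rightAngle {suc a} N₀ s ra = left-edge-below-covered N₀ W₀ ra ¬covered
    where
    W₀ : C (suc a , 0 , W)
    W₀ = chunk-fwd N₀ (lNW (valid N₀) (below-midpoint∉A s ∘ proj₂ ∘ covered-centre-NW (suc a) 0))
    ¬covered : ¬ Covered m n u (cor (suc a) 0) (cor (suc a) 1)
    ¬covered cv with covered-vedge (suc a) 0 cv
    ... | first-half t = inA⇒¬inA-up (VSegment.bottom∈A t) (HSegment.left∈A s)

  chunk-below : ∀ {a j b} → C (a , j , N) → a < b → ActiveH m n u (suc j) a b →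
                RightAngleAt C a (suc j) → RightAngleAt C b (suc j) → IsSquare2 C
  chunk-below {a} {j} N₀ a<b act ra rb with covered-hedge a (suc j) (act a ℕₚ.≤-refl a<b)
  chunk-below {j = zero}  N₀ a<b act ra rb | first-half s = ⊥-elim (first-row-¬rightAngle N₀ s ra)
  chunk-below {j = suc q} N₀ a<b act ra rb | first-half s = Below.isSquare2 N₀ ra s a<b act rb
  chunk-below             N₀ a<b act ra rb | second-half s = ⊥-elim (midpoint-¬rightAngle-below N₀ s ra)

  horizontal-side : ∀ {a j b} → aboveH C a j ⊎ belowH C a j → a < b → ActiveH m n u j a b →
                    RightAngleAt C a j → RightAngleAt C b j → IsSquare2 C
  horizontal-side (inj₁ S₀) = chunk-above S₀
  horizontal-side {j = suc j} (inj₂ N₀) = chunk-below N₀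

lemma7 : (m n : ℕ) → 2 ≤ m → 2 ≤ n →
    (u : Point → Bool) → InKerBW m n u → NonZeroU m n u →
    (c₀ : Cell) → ValidCell m n c₀ →
    HasActiveRightSide m n u (Chunk m n u c₀) →
    IsSquare2 (Chunk m n u c₀)
lemma7 m n _ _ u K _ c₀ v₀ (inj₁ (j , a , b , (a<b , boundary , _ , _) , act , ra , rb)) =
  ActiveSide.horizontal-side K v₀ (beside (boundary a ℕₚ.≤-refl a<b)) a<b act ra rb
  where
  beside : BdH (Chunk m n u c₀) a j → aboveH (Chunk m n u c₀) a j ⊎ belowH (Chunk m n u c₀) a j
  beside (inj₁ (below , _)) = inj₂ below
  beside (inj₂ (_ , above)) = inj₁ above
lemma7 m n _ _ u K _ c₀ v₀ (inj₂ (i , a , b , (a<b , boundary , _ , _) , act , ra , rb)) =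
  IsSquare2-untranspose (ActiveSide.horizontal-side (InKerBW-transpose K) (swap v₀)
    (beside-transpose (boundary a ℕₚ.≤-refl a<b)) a<b (λ y a≤y y<b → Covered-transpose (act y a≤y y<b))
    (RightAngleAt-transpose to from ra) (RightAngleAt-transpose to from rb))
  where
  to : ∀ c → Chunk m n u c₀ (flipCell c) → Chunk n m (transpose u) (flipCell c₀) c
  to c p = subst (Chunk n m (transpose u) (flipCell c₀)) (flipCell-involutive c) (Chunk-transpose p)
  from : ∀ c → Chunk n m (transpose u) (flipCell c₀) c → Chunk m n u c₀ (flipCell c)
  from _ = Chunk-untranspose
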